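{- Let $[P,Q]$ be a synchronized interval and $T=\mathrm{R}([P,Q])$. Then $\mathrm{P}(T)=P$ and $\mathrm{Q}(T)=Q$.
   Context: A Dyck path of size $n$ is a word with $n$ letters $u=(1,1)$ and $n$ letters $d=(1,-1)$ whose walk from $(0,0)$ never goes below the $x$-axis. Tamari order: if $P=A\,d\,U\,C$ where $U=uBd$ is a Dyck path which returns to its starting height only at its end, then $P$ is covered by $A\,U\,d\,C$; the Tamari order $\le$ is the reflexive–transitive closure. For a Dyck path $P$ of size $n$ with up steps at positions $i_1<\dots<i_n$, $\mathrm{Type}(P)=w_1\cdots w_{n-1}$ where $w_k=E$ if the step at position $i_k+1$ is $u$ and $w_k=N$ otherwise. A synchronized interval is a pair $[P,Q]$ of Dyck paths of the same size $n\ge1$ with $P\le Q$ in Tamari order and $\mathrm{Type}(P)=\mathrm{Type}(Q)$. Rooted plane trees: children of each vertex are linearly ordered; the root has depth $0$; a leaf is a non-root vertex without children, other vertices are internal; an internal edge is one whose lower endpoint is internal. The traversal is the depth-first traversal from the root visiting children in order; the traversal order of leaves is the order in which it meets them. The contour word of a plane tree writes $u$ when an edge is traversed away from the root and $d$ when traversed back; it is a bijection between plane trees with $n$ edges and Dyck paths of size $n$, the $i$-th up step corresponding to the $i$-th edge in traversal order, and leaves corresponding to up steps immediately followed by a down step. The map $\mathrm{R}$: given $[P,Q]$, let $T$ be the plane tree whose contour word is $Q$. For each leaf $\ell$ corresponding to the $i$-th up step of $Q$, consider in $P$ the lowest point $x$ of the maximal run of consecutive down steps following the $i$-th up step of $P$;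 draw a horizontal ray from $x$ to the left until it first meets a point of $P$ which is the common point of two consecutive up steps. If this exists and the lower of these up steps is the $j$-th up step of $P$, let $e$ be the edge of $T$ corresponding to the $j$-th up step of $Q$ and label $\ell$ with the depth of the endpoint of $e$ closer to the root; otherwise label $\ell$ with $-1$. This gives $\mathrm{R}([P,Q])$. For a rooted plane tree $T$ with integer leaf labels: $\mathrm{Q}(T)$ is its contour word. $\mathrm{P}(T)$: give each leaf charge $0$; for each internal vertex of depth $p>0$, add $1$ to the charge of the first leaf (in traversal order) among its descendants having label $\le p-2$. Then, during the traversal, append $u$ when an internal edge is first visited and $u d^{1+k}$ when a leaf of charge $k$ is first visited; the resulting word is $\mathrm{P}(T)$. -}

module Defs where

open import Data.Nat using (ℕ; zero; suc; _∸_; _<ᵇ_; _≤_)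
open import Data.Integer as ℤ using (ℤ; +_; -[1+_]; 0ℤ)
open import Data.Bool using (Bool; true; false; if_then_else_; _∧_)
open import Data.List using (List; []; _∷_; _++_; length; take; replicate; filterᵇ; last; map)
open import Data.Maybe using (Maybe; just; nothing)
open import Data.Product using (_×_; _,_; proj₂)
open import Relation.Nullary using (¬_; does)
open import Relation.Binary.PropositionalEquality using (_≡_)
open import Relation.Binary.Construct.Closure.ReflexiveTransitive using (Star)

data Step : Set where
  u d : Step

height : List Step → ℤ
height [] = 0ℤ
height (u ∷ w) = ℤ.suc (height w)
height (d ∷ w) = ℤ.pred (height w)

size : List Step → ℕ
size [] = 0
size (u ∷ w) = suc (size w)
size (d ∷ w) = size w

IsDyck : List Step → Set
IsDyck w = (∀ a b → a ++ b ≡ w → 0ℤ ℤ.≤ height a) × height w ≡ 0ℤ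

Primitive : List Step → Set
Primitive U = IsDyck U ×
  (∀ a b → a ++ b ≡ U → ¬ (a ≡ []) → ¬ (b ≡ []) → ¬ (height a ≡ 0ℤ))

data Covers : List Step → List Step → Set where
  cover : ∀ A B C → Primitive (u ∷ B ++ d ∷ []) →
          Covers (A ++ d ∷ (u ∷ B ++ d ∷ []) ++ C) (A ++ (u ∷ B ++ d ∷ []) ++ d ∷ C)

_≤T_ : List Step → List Step → Set
_≤T_ = Star Covers

data Letter : Set where
  E N : Letter

upLetters : List Step → List Letter
upLetters [] = []
upLetters (d ∷ w) = upLetters w
upLetters (u ∷ []) = N ∷ []
upLetters (u ∷ u ∷ w) = E ∷ upLetters (u ∷ w)
upLetters (u ∷ d ∷ w) = N ∷ upLetters (d ∷ w)

dropLast : {A : Set} → List A → List A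
dropLast [] = []
dropLast (x ∷ []) = []
dropLast (x ∷ y ∷ xs) = x ∷ dropLast (y ∷ xs)

Type : List Step → List Letter
Type w = dropLast (upLetters w)

Synchronized : List Step → List Step → Set
Synchronized P Q =
  IsDyck P × IsDyck Q × size P ≡ size Q × 1 ≤ size P × P ≤T Q × Type P ≡ Type Q

data PTree : Set where
  node : List PTree → PTree

mutual
  parseF : ℕ → List Step → Maybe (List PTree × List Step)
  parseF zero w = nothing
  parseF (suc k) [] = just ([] , [])
  parseF (suc k) (d ∷ w) = just ([] , d ∷ w)
  parseF (suc k) (u ∷ w) = parseAfterChildren k (parseF k w)

  parseAfterChildren : ℕ → Maybe (List PTree × List Step) → Maybe (List PTree × List Step)
  parseAfterChildren k (just (cs , d ∷ w')) = addFirst cs (parseF k w')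
  parseAfterChildren k _ = nothing

  addFirst : List PTree → Maybe (List PTree × List Step) → Maybe (List PTree × List Step)
  addFirst cs (just (ts , w'')) = just (node cs ∷ ts , w'')
  addFirst cs nothing = nothing

decodeAux : Maybe (List PTree × List Step) → Maybe PTree
decodeAux (just (ts , [])) = just (node ts)
decodeAux _ = nothing

decode : List Step → Maybe PTree
decode w = decodeAux (parseF (suc (length w)) w)

-- depths of the upper (root-side) endpoints of the edges, in traversal order
mutual
  edgeDepthsF : ℕ → List PTree → List ℕ
  edgeDepthsF p [] = []
  edgeDepthsF p (t ∷ ts) = edgeDepthsT p t ++ edgeDepthsF p ts

  edgeDepthsT : ℕ → PTree → List ℕ
  edgeDepthsT p (node cs) = p ∷ edgeDepthsF (suc p) cs

rootEdgeDepths : PTree → List ℕ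
rootEdgeDepths (node cs) = edgeDepthsF 0 cs

-- A labelled tree is given by the ordered
-- list of subtrees hanging from the root; a non-root vertex is a leaf
-- (carrying an integer label) or an internal vertex with its children.

data LTree : Set where
  leaf  : ℤ → LTree
  inner : List LTree → LTree

LabelledTree : Set
LabelledTree = List LTree

mutual
  contourF : List LTree → List Step
  contourF [] = []
  contourF (t ∷ ts) = contourT t ++ contourF ts

  contourT : LTree → List Step
  contourT (leaf _) = u ∷ d ∷ []
  contourT (inner cs) = u ∷ contourF cs ++ d ∷ []

Qmap : LabelledTree → List Step
Qmap = contourF

bump : ℤ → List (ℤ × ℕ) → List (ℤ × ℕ)
bump c [] = []
bump c ((l , k) ∷ xs) = if does (l ℤ.≤? c) then (l , suc k) ∷ xs else (l , k) ∷ bump c xs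

-- (label, charge) of the leaves in traversal order; p = depth of the vertices
mutual
  chargesF : ℕ → List LTree → List (ℤ × ℕ)
  chargesF p [] = []
  chargesF p (t ∷ ts) = chargesT p t ++ chargesF p ts

  chargesT : ℕ → LTree → List (ℤ × ℕ)
  chargesT p (leaf l) = (l , 0) ∷ []
  chargesT p (inner cs) = bump (+ p ℤ.- + 2) (chargesF (suc p) cs)

-- traversal order of non-root vertices: true = leaf, false = internal
mutual
  shapeF : List LTree → List Bool
  shapeF [] = []
  shapeF (t ∷ ts) = shapeT t ++ shapeF ts

  shapeT : LTree → List Bool
  shapeT (leaf _) = true ∷ []
  shapeT (inner cs) = false ∷ shapeF cs

emit : List Bool → List ℕ → List Step
emit [] ks = []
emit (false ∷ bs) ks = u ∷ emit bs ks
emit (true ∷ bs) [] = []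
emit (true ∷ bs) (k ∷ ks) = u ∷ replicate (suc k) d ++ emit bs ks

Pmap : LabelledTree → List Step
Pmap T = emit (shapeF T) (map proj₂ (chargesF 1 T))

nth : {A : Set} → List A → ℕ → Maybe A
nth [] n = nothing
nth (x ∷ xs) zero = just x
nth (x ∷ xs) (suc n) = nth xs n

-- step positions (0-based; step k goes from point k to point k+1) of up steps
upPositionsFrom : ℕ → List Step → List ℕ
upPositionsFrom k [] = []
upPositionsFrom k (u ∷ w) = k ∷ upPositionsFrom (suc k) w
upPositionsFrom k (d ∷ w) = upPositionsFrom (suc k) w

-- points k that are the common point of two consecutive up steps
doubleUpsFrom : ℕ → List Step → List ℕ
doubleUpsFrom k [] = []
doubleUpsFrom k (u ∷ u ∷ w) = suc k ∷ doubleUpsFrom (suc k) (u ∷ w)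
doubleUpsFrom k (s ∷ w) = doubleUpsFrom (suc k) w

heightAt : List Step → ℕ → ℤ
heightAt w k = height (take k w)

downRun : List Step → ℕ
downRun (d ∷ w) = suc (downRun w)
downRun _ = 0

drop' : ℕ → List Step → List Step
drop' zero w = w
drop' (suc n) [] = []
drop' (suc n) (s ∷ w) = drop' n w

-- lowest point x of the maximal run of down steps following the step at position p
lowestAfter : List Step → ℕ → ℕ
lowestAfter P p = suc p Data.Nat.+ downRun (drop' (suc p) P)

-- nearest double-up point to the left of the point x, at the same height
rayHit : List Step → ℕ → Maybe ℕ
rayHit P x = last (filterᵇ (λ k → (k <ᵇ x) ∧ does (heightAt P k ℤ.≟ heightAt P x)) (doubleUpsFrom 0 P))

labelAux : List ℕ → List Step → Maybe ℕ → ℤ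
labelAux depths P (just k) with nth depths (size (take (k ∸ 1) P))
... | just p = + p
... | nothing = -[1+ 0 ]
labelAux depths P nothing = -[1+ 0 ]

-- label of the leaf corresponding to the i-th (0-based) up step of Q;
-- depths = depths of root-side endpoints of the edges of T in traversal order
leafLabel : List Step → List ℕ → ℕ → ℤ
leafLabel P depths i with nth (upPositionsFrom 0 P) i
... | just p = labelAux depths P (rayHit P (lowestAfter P p))
... | nothing = -[1+ 0 ]

-- turn a plane tree into a leaf-labelled tree; the counter is the
-- (0-based) traversal index of the next edge
mutual
  labelF : (ℕ → ℤ) → ℕ → List PTree → List LTree × ℕ
  labelF f i [] = [] , i
  labelF f i (t ∷ ts) with labelT f i t
  ... | (t' , j) with labelF f j ts
  ...   | (ts' , k) = t' ∷ ts' , k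

  labelT : (ℕ → ℤ) → ℕ → PTree → LTree × ℕ
  labelT f i (node []) = leaf (f i) , suc i
  labelT f i (node (c ∷ cs)) with labelF f (suc i) (c ∷ cs)
  ... | (cs' , j) = inner cs' , j

labelRoot : List Step → PTree → LabelledTree
labelRoot P (node cs) with labelF (leafLabel P (rootEdgeDepths (node cs))) 0 cs
... | (T , _) = T

RAux : List Step → Maybe PTree → Maybe LabelledTree
RAux P (just t) = just (labelRoot P t)
RAux P nothing = nothing

R : List Step → List Step → Maybe LabelledTree
R P Q = RAux P (decode Q)

-- Write P and Q as contour words of plane forests. Equal Types mean equal
-- leaf/internal patterns in traversal order, and P ≤ Q means that the subtree
-- below every edge is at most as large in P as in Q, since a Tamari covering
-- step only lengthens the excursions starting before the rotated factor. In P,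
-- the ray from the bottom of the descent after a leaf stops at the foot of the
-- smallest excursion strictly containing that descent, so the leaf is labelled
-- by the depth in Q of that edge, or -1. Hence, for an internal vertex of depth
-- p, the leaves of its P-subtree have labels at least p - 1 except the last
-- one, whose label is at most p - 2: every internal vertex charges the last
-- leaf of its P-subtree. A leaf of P is followed by one down step plus one for
-- each P-subtree it closes, which is exactly what P(T) emits; Q(T) = Q because
-- T is built on the tree with contour word Q.

module Submission where

open import Defs
open import Data.Bool using (Bool; true; false; _∧_; if_then_else_; T)
open import Data.Empty using (⊥-elim)
open import Data.Integer as Z using (ℤ; +_; -[1+_]; 0ℤ) renaming (_+_ to _+ℤ_; _≤_ to _≤ℤ_; _-_ to _-ℤ_)
import Data.Integer.Properties as ZP
open import Data.List using (List; []; _∷_; _++_; length; take; drop; map; replicate; filterᵇ; last)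
import Data.List.Properties as LP
open import Data.List.Membership.Propositional using (_∈_)
open import Data.List.Membership.Propositional.Properties using (∈-++⁺ˡ; ∈-++⁺ʳ; ∈-++⁻; ∈-∃++)
open import Data.List.Relation.Unary.All as All using (All; []; _∷_)
open import Data.List.Relation.Unary.AllPairs as AllPairs using (AllPairs; []; _∷_)
import Data.List.Relation.Unary.AllPairs.Properties as AllPairsP
open import Data.List.Relation.Unary.Any using (here; there)
open import Data.Maybe using (just; nothing; maybe)
open import Data.Nat as N using (ℕ; zero; suc; _+_; _∸_; _≤_; _<_; z≤n; s≤s; _<ᵇ_)
import Data.Nat.Properties as NP
open import Data.Product using (Σ; _×_; _,_; proj₁; proj₂)
open import Data.Sum using (_⊎_; inj₁; inj₂)
open import Data.Unit using (⊤; tt)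
open import Function using (case_of_)
open import Relation.Binary.Construct.Closure.ReflexiveTransitive using (ε; _◅_)
open import Relation.Binary.Definitions using (tri<; tri≈; tri>)
open import Relation.Binary.PropositionalEquality
open import Relation.Nullary using (¬_; does; yes; no; Dec)
open import Relation.Nullary.Decidable using (dec-true; dec-false)

private
  variable
    A : Set

nth-++ʳ : ∀ (a v : List A) j → nth (a ++ v) (length a + j) ≡ nth v j
nth-++ʳ []      v j = refl
nth-++ʳ (x ∷ a) v j = nth-++ʳ a v j

nth-++ˡ : ∀ (a v : List A) j → j < length a → nth (a ++ v) j ≡ nth a j
nth-++ˡ (x ∷ a) v zero    _         = refl
nth-++ˡ (x ∷ a) v (suc j) (s≤s j<a) = nth-++ˡ a v j j<a

nth-map : ∀ {B : Set} (f : A → B) (xs : List A) j → nth (map f xs) j ≡ Data.Maybe.map f (nth xs j)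
nth-map f []       j       = refl
nth-map f (x ∷ xs) zero    = refl
nth-map f (x ∷ xs) (suc j) = nth-map f xs j

nth-just : ∀ (w : List A) t → t < length w → Σ A λ s → nth w t ≡ just s
nth-just (x ∷ w) zero    _         = x , refl
nth-just (x ∷ w) (suc t) (s≤s t<w) = nth-just w t t<w

nth-just-< : ∀ (w : List A) t {s} → nth w t ≡ just s → t < length w
nth-just-< (x ∷ w) zero    _  = s≤s z≤n
nth-just-< (x ∷ w) (suc t) eq = s≤s (nth-just-< w t eq)

nth-∈ : ∀ (xs : List A) j {x} → nth xs j ≡ just x → x ∈ xs
nth-∈ (y ∷ xs) zero    refl = here refl
nth-∈ (y ∷ xs) (suc j) eq   = there (nth-∈ xs j eq)

take-++ʳ : ∀ (a v : List A) j → take (length a + j) (a ++ v) ≡ a ++ take j v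
take-++ʳ []      v j = refl
take-++ʳ (x ∷ a) v j = cong (x ∷_) (take-++ʳ a v j)

take-++ˡ : ∀ (a v : List A) j → j ≤ length a → take j (a ++ v) ≡ take j a
take-++ˡ a       v zero    _         = refl
take-++ˡ (x ∷ a) v (suc j) (s≤s j≤a) = cong (x ∷_) (take-++ˡ a v j j≤a)

take-length-++ : ∀ (a v : List A) → take (length a) (a ++ v) ≡ a
take-length-++ []      v = refl
take-length-++ (x ∷ a) v = cong (x ∷_) (take-length-++ a v)

nth-length-++ : ∀ (a : List A) x v → nth (a ++ x ∷ v) (length a) ≡ just x
nth-length-++ []      x v = refl
nth-length-++ (y ∷ a) x v = nth-length-++ a x v

take-suc-nth : ∀ (w : List A) t s → nth w t ≡ just s → take (suc t) w ≡ take t w ++ s ∷ []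
take-suc-nth (x ∷ w) zero    s refl = refl
take-suc-nth (x ∷ w) (suc t) s eq   = cong (x ∷_) (take-suc-nth w t s eq)

index-split : ∀ m n → n < m ⊎ Σ ℕ λ k → n ≡ m + k
index-split zero    n       = inj₂ (n , refl)
index-split (suc m) zero    = inj₁ (s≤s z≤n)
index-split (suc m) (suc n) with index-split m n
... | inj₁ n<m       = inj₁ (s≤s n<m)
... | inj₂ (k , n≡m+k) = inj₂ (k , cong suc n≡m+k)

-- Prefixes of Dyck paths: heights and numbers of up steps

height-++ : ∀ a b → height (a ++ b) ≡ height a +ℤ height b
height-++ []      b = sym (ZP.+-identityˡ _)
height-++ (u ∷ a) b = trans (cong (Z.1ℤ +ℤ_) (height-++ a b)) (sym (ZP.+-assoc Z.1ℤ (height a) (height b)))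
height-++ (d ∷ a) b = trans (cong (Z.-1ℤ +ℤ_) (height-++ a b)) (sym (ZP.+-assoc Z.-1ℤ (height a) (height b)))

heightAt-++ : ∀ (a v : List Step) j → heightAt (a ++ v) (length a + j) ≡ height a +ℤ heightAt v j
heightAt-++ a v j = trans (cong height (take-++ʳ a v j)) (height-++ a (take j v))

heightAt-step : ∀ w t s → nth w t ≡ just s → heightAt w (suc t) ≡ heightAt w t +ℤ height (s ∷ [])
heightAt-step w t s eq = trans (cong height (take-suc-nth w t s eq)) (height-++ (take t w) (s ∷ []))

size-++ : ∀ a b → size (a ++ b) ≡ size a + size b
size-++ []      b = refl
size-++ (u ∷ a) b = cong suc (size-++ a b)
size-++ (d ∷ a) b = size-++ a b

ups : List Step → ℕ → ℕ
ups w t = size (take t w)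

ups-step : ∀ w t s → nth w t ≡ just s → ups w (suc t) ≡ ups w t + size (s ∷ [])
ups-step w t s eq = trans (cong size (take-suc-nth w t s eq)) (size-++ (take t w) (s ∷ []))

ups-up : ∀ w t → nth w t ≡ just u → ups w (suc t) ≡ suc (ups w t)
ups-up w t eq = trans (ups-step w t u eq) (NP.+-comm _ 1)

ups-down : ∀ w t → nth w t ≡ just d → ups w (suc t) ≡ ups w t
ups-down w t eq = trans (ups-step w t d eq) (NP.+-identityʳ _)

ups-mono : ∀ w {t t'} → t ≤ t' → ups w t ≤ ups w t'
ups-mono w       z≤n        = z≤n
ups-mono []      (s≤s t≤t') = z≤n
ups-mono (u ∷ w) (s≤s t≤t') = s≤s (ups-mono w t≤t')
ups-mono (d ∷ w) (s≤s t≤t') = ups-mono w t≤t'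

ups≤size : ∀ w t → ups w t ≤ size w
ups≤size []      zero    = z≤n
ups≤size []      (suc t) = z≤n
ups≤size (x ∷ w) zero    = z≤n
ups≤size (u ∷ w) (suc t) = s≤s (ups≤size w t)
ups≤size (d ∷ w) (suc t) = ups≤size w t

NonNegative : List Step → Set
NonNegative w = ∀ t → 0ℤ ≤ℤ heightAt w t

level : List Step → ℕ → ℕ
level w t = Z.∣ heightAt w t ∣

level-height : ∀ w → NonNegative w → ∀ t → + level w t ≡ heightAt w t
level-height w w≥0 t = ZP.0≤i⇒+∣i∣≡i (w≥0 t)

level-up : ∀ w → NonNegative w → ∀ t → nth w t ≡ just u → level w (suc t) ≡ suc (level w t)
level-up w w≥0 t eq = ZP.+-injective (begin
  + level w (suc t)             ≡⟨ level-height w w≥0 (suc t) ⟩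
  heightAt w (suc t)            ≡⟨ heightAt-step w t u eq ⟩
  heightAt w t +ℤ Z.1ℤ          ≡⟨ cong (_+ℤ Z.1ℤ) (sym (level-height w w≥0 t)) ⟩
  + (level w t + 1)             ≡⟨ cong +_ (NP.+-comm (level w t) 1) ⟩
  + suc (level w t)             ∎)
  where open ≡-Reasoning

level-down : ∀ w → NonNegative w → ∀ t → nth w t ≡ just d → level w t ≡ suc (level w (suc t))
level-down w w≥0 t eq = pred-level (level w t) (level w (suc t))
  (trans (level-height w w≥0 (suc t)) (trans (heightAt-step w t d eq) (cong (_+ℤ Z.-1ℤ) (sym (level-height w w≥0 t)))))
  where
  pred-level : ∀ a b → + b ≡ + a +ℤ Z.-1ℤ → a ≡ suc b
  pred-level zero    b ()
  pred-level (suc a) b eq = cong suc (sym (ZP.+-injective eq))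

-- Contour words of plane trees

-- wordT t is the contour of t together with the edge above its root.
mutual
  wordT : PTree → List Step
  wordT (node cs) = u ∷ wordF cs ++ d ∷ []

  wordF : List PTree → List Step
  wordF []       = []
  wordF (t ∷ ts) = wordT t ++ wordF ts

mutual
  sizeT : PTree → ℕ
  sizeT (node cs) = suc (sizeF cs)

  sizeF : List PTree → ℕ
  sizeF []       = 0
  sizeF (t ∷ ts) = sizeT t + sizeF ts

mutual
  size-wordT : ∀ t → size (wordT t) ≡ sizeT t
  size-wordT (node cs) = cong suc (trans (size-++ (wordF cs) (d ∷ [])) (trans (NP.+-identityʳ _) (size-wordF cs)))

  size-wordF : ∀ cs → size (wordF cs) ≡ sizeF cs
  size-wordF []       = refl
  size-wordF (t ∷ ts) = trans (size-++ (wordT t) (wordF ts)) (cong₂ _+_ (size-wordT t) (size-wordF ts))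

mutual
  height-wordT : ∀ t → height (wordT t) ≡ 0ℤ
  height-wordT (node cs) = cong Z.suc (trans (height-++ (wordF cs) (d ∷ [])) (cong (_+ℤ Z.-1ℤ) (height-wordF cs)))

  height-wordF : ∀ cs → height (wordF cs) ≡ 0ℤ
  height-wordF []       = refl
  height-wordF (t ∷ ts) = trans (height-++ (wordT t) (wordF ts)) (cong₂ _+ℤ_ (height-wordT t) (height-wordF ts))

height-wordF-d : ∀ cs → height (wordF cs ++ d ∷ []) ≡ Z.-1ℤ
height-wordF-d cs = trans (height-++ (wordF cs) (d ∷ [])) (cong (_+ℤ Z.-1ℤ) (height-wordF cs))

mutual
  wordT-nonneg : ∀ t → NonNegative (wordT t)
  wordT-nonneg (node cs) zero = Z.+≤+ z≤n
  wordT-nonneg (node cs) (suc j) with index-split (length (wordF cs)) j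
  ... | inj₁ j<cs rewrite take-++ˡ (wordF cs) (d ∷ []) j (NP.<⇒≤ j<cs) = suc-nonneg (wordF-nonneg cs j)
    where
    suc-nonneg : ∀ {z} → 0ℤ ≤ℤ z → 0ℤ ≤ℤ Z.suc z
    suc-nonneg {+ n} _ = Z.+≤+ z≤n
  ... | inj₂ (k , refl) rewrite heightAt-++ (wordF cs) (d ∷ []) k | height-wordF cs = last-step k
    where
    last-step : ∀ k → 0ℤ ≤ℤ Z.suc (0ℤ +ℤ heightAt (d ∷ []) k)
    last-step zero          = Z.+≤+ z≤n
    last-step (suc zero)    = Z.+≤+ z≤n
    last-step (suc (suc k)) = Z.+≤+ z≤n

  wordF-nonneg : ∀ cs → NonNegative (wordF cs)
  wordF-nonneg []       zero    = Z.+≤+ z≤n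
  wordF-nonneg []       (suc j) = Z.+≤+ z≤n
  wordF-nonneg (t ∷ ts) j with index-split (length (wordT t)) j
  ... | inj₁ j<t rewrite take-++ˡ (wordT t) (wordF ts) j (NP.<⇒≤ j<t) = wordT-nonneg t j
  ... | inj₂ (k , refl)
    rewrite heightAt-++ (wordT t) (wordF ts) k | height-wordT t | ZP.+-identityˡ (heightAt (wordF ts) k)
    = wordF-nonneg ts k

wordT-positive : ∀ t j → 0 < j → j < length (wordT t) → Σ ℕ λ m → heightAt (wordT t) j ≡ + suc m
wordT-positive (node cs) (suc j) _ (s≤s j<t) with index-split (length (wordF cs)) j
... | inj₁ j<cs rewrite take-++ˡ (wordF cs) (d ∷ []) j (NP.<⇒≤ j<cs) = suc-positive (wordF-nonneg cs j)
  where
  suc-positive : ∀ {z} → 0ℤ ≤ℤ z → Σ ℕ λ m → Z.suc z ≡ + suc m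
  suc-positive {+ n} _ = n , refl
... | inj₂ (zero , refl) rewrite heightAt-++ (wordF cs) (d ∷ []) zero | height-wordF cs = zero , refl
... | inj₂ (suc k , refl) rewrite LP.length-++ (wordF cs) {d ∷ []}
  with NP.+-cancelˡ-< (length (wordF cs)) (suc k) 1 j<t
... | s≤s ()

length-wordT≥2 : ∀ t → 2 ≤ length (wordT t)
length-wordT≥2 (node cs) =
  s≤s (subst (1 ≤_) (sym (LP.length-++ (wordF cs) {d ∷ []})) (NP.m≤n+m 1 (length (wordF cs))))

EndsParse : List Step → Set
EndsParse r = r ≡ [] ⊎ Σ (List Step) λ r' → r ≡ d ∷ r'

wordF-node : ∀ c cs r → ((wordF c ++ d ∷ []) ++ wordF cs) ++ r ≡ wordF c ++ d ∷ (wordF cs ++ r)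
wordF-node c cs r = trans (LP.++-assoc (wordF c ++ d ∷ []) (wordF cs) r) (LP.++-assoc (wordF c) (d ∷ []) (wordF cs ++ r))

parse-fuel : ∀ c cs k → length (wordF (node c ∷ cs)) < suc k → length (wordF c) < k × length (wordF cs) < k
parse-fuel c cs k lt = NP.≤-trans (s≤s (NP.m≤m+n _ _)) lt′ , NP.≤-trans (NP.m≤n+m _ _) (NP.<⇒≤ lt′)
  where
  lt′ : length (wordF c) + suc (length (wordF cs)) < k
  lt′ = NP.≤-pred (subst (_< suc k) length-node lt)
    where
    length-node : length (wordF (node c ∷ cs)) ≡ suc (length (wordF c) + suc (length (wordF cs)))
    length-node rewrite LP.length-++ (u ∷ wordF c ++ d ∷ []) {wordF cs} | LP.length-++ (wordF c) {d ∷ []}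
      = cong suc (NP.+-assoc (length (wordF c)) 1 _)

parseF-wordF : ∀ cs r k → length (wordF cs) < k → EndsParse r → parseF k (wordF cs ++ r) ≡ just (cs , r)
parseF-wordF []             r (suc k) _  (inj₁ refl)       = refl
parseF-wordF []             r (suc k) _  (inj₂ (r' , refl)) = refl
parseF-wordF (node c ∷ cs) r (suc k) lt stop
  rewrite wordF-node c cs r
        | parseF-wordF c (d ∷ (wordF cs ++ r)) k (proj₁ (parse-fuel c cs k lt)) (inj₂ (_ , refl))
        | parseF-wordF cs r k (proj₂ (parse-fuel c cs k lt)) stop
  = refl

decode-wordF : ∀ cs → decode (wordF cs) ≡ just (node cs)
decode-wordF cs = cong decodeAux (begin
  parseF (suc (length (wordF cs))) (wordF cs)       ≡⟨ cong (parseF (suc (length (wordF cs)))) (sym (LP.++-identityʳ (wordF cs))) ⟩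
  parseF (suc (length (wordF cs))) (wordF cs ++ []) ≡⟨ parseF-wordF cs [] _ NP.≤-refl (inj₁ refl) ⟩
  just (cs , [])                                    ∎)
  where open ≡-Reasoning

PositiveHeight : List Step → Set
PositiveHeight r = Σ ℕ λ m → height r ≡ + suc m

wordF-prefix : ∀ n w → length w ≤ n →
  Σ (List PTree) λ cs → Σ (List Step) λ r → (w ≡ wordF cs ++ r) × (EndsParse r ⊎ PositiveHeight r)
wordF-prefix n       []      _ = [] , [] , refl , inj₁ (inj₁ refl)
wordF-prefix n       (d ∷ w) _ = [] , d ∷ w , refl , inj₁ (inj₂ (w , refl))
wordF-prefix (suc n) (u ∷ w) (s≤s w≤n) with wordF-prefix n w w≤n
... | cs , r , refl , inj₁ (inj₁ refl) =
  [] , u ∷ w , refl , inj₂ (0 , cong Z.suc (trans (cong height (LP.++-identityʳ (wordF cs))) (height-wordF cs)))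
... | cs , r , refl , inj₂ (m , r>0) =
  [] , u ∷ wordF cs ++ r , refl , inj₂ (suc m , cong Z.suc (trans (height-++ (wordF cs) r) (cong₂ _+ℤ_ (height-wordF cs) r>0)))
... | cs , .(d ∷ r) , refl , inj₁ (inj₂ (r , refl)) with wordF-prefix n r r≤n
  where
  r≤n : length r ≤ n
  r≤n = NP.≤-trans (NP.≤-trans (NP.n≤1+n _) (NP.m≤n+m (suc (length r)) (length (wordF cs))))
                   (NP.≤-trans (NP.≤-reflexive (sym (LP.length-++ (wordF cs) {d ∷ r}))) w≤n)
... | cs′ , r′ , refl , stop = node cs ∷ cs′ , r′ , sym (cong (u ∷_) (wordF-node cs cs′ r′)) , stop

dyck⇒wordF : ∀ w → IsDyck w → Σ (List PTree) λ cs → wordF cs ≡ w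
dyck⇒wordF w (w≥0 , w=0) with wordF-prefix (length w) w NP.≤-refl
... | cs , r , eq , inj₁ (inj₁ refl) = cs , trans (sym (LP.++-identityʳ (wordF cs))) (sym eq)
... | cs , r , eq , inj₁ (inj₂ (r' , refl)) =
  ⊥-elim (0≰-1 (subst (0ℤ ≤ℤ_) (height-wordF-d cs)
    (w≥0 (wordF cs ++ d ∷ []) r' (trans (LP.++-assoc (wordF cs) (d ∷ []) r') (sym eq)))))
  where
  0≰-1 : ¬ (0ℤ ≤ℤ Z.-1ℤ)
  0≰-1 ()
... | cs , r , eq , inj₂ (m , r>0) =
  ⊥-elim (0≢1+m (trans (sym w=0) (trans (cong height eq) (trans (height-++ (wordF cs) r) (cong₂ _+ℤ_ (height-wordF cs) r>0)))))
  where
  0≢1+m : 0ℤ ≢ + suc m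
  0≢1+m ()

-- Edges of a forest in traversal order

-- The g-th entry is the subtree hanging from the g-th edge together with
-- the depth of the upper endpoint of that edge.
mutual
  subtreesT : ℕ → PTree → List (PTree × ℕ)
  subtreesT p (node cs) = (node cs , p) ∷ subtreesF (suc p) cs

  subtreesF : ℕ → List PTree → List (PTree × ℕ)
  subtreesF p []       = []
  subtreesF p (t ∷ ts) = subtreesT p t ++ subtreesF p ts

mutual
  length-subtreesT : ∀ p t → length (subtreesT p t) ≡ sizeT t
  length-subtreesT p (node cs) = cong suc (length-subtreesF (suc p) cs)

  length-subtreesF : ∀ p ts → length (subtreesF p ts) ≡ sizeF ts
  length-subtreesF p []       = refl
  length-subtreesF p (t ∷ ts) =
    trans (LP.length-++ (subtreesT p t)) (cong₂ _+_ (length-subtreesT p t) (length-subtreesF p ts))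

mutual
  edgeDepthsT-subtrees : ∀ p t → edgeDepthsT p t ≡ map proj₂ (subtreesT p t)
  edgeDepthsT-subtrees p (node cs) = cong (p ∷_) (edgeDepthsF-subtrees (suc p) cs)

  edgeDepthsF-subtrees : ∀ p ts → edgeDepthsF p ts ≡ map proj₂ (subtreesF p ts)
  edgeDepthsF-subtrees p []       = refl
  edgeDepthsF-subtrees p (t ∷ ts) =
    trans (cong₂ _++_ (edgeDepthsT-subtrees p t) (edgeDepthsF-subtrees p ts))
          (sym (LP.map-++ proj₂ (subtreesT p t) (subtreesF p ts)))

subtreesF-lookup : ∀ cs m → m < sizeF cs → Σ (PTree × ℕ) λ x → nth (subtreesF 0 cs) m ≡ just x
subtreesF-lookup cs m m<cs = nth-just (subtreesF 0 cs) m (subst (m <_) (sym (length-subtreesF 0 cs)) m<cs)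

mutual
  depth-belowT : ∀ p t x → x ∈ subtreesT p t → p ≤ proj₂ x
  depth-belowT p (node cs) x (here refl) = NP.≤-refl
  depth-belowT p (node cs) x (there x∈) = NP.≤-trans (NP.n≤1+n p) (depth-belowF (suc p) cs x x∈)

  depth-belowF : ∀ p ts x → x ∈ subtreesF p ts → p ≤ proj₂ x
  depth-belowF p (t ∷ ts) x x∈ with ∈-++⁻ (subtreesT p t) x∈
  ... | inj₁ x∈t  = depth-belowT p t x x∈t
  ... | inj₂ x∈ts = depth-belowF p ts x x∈ts

Segment : List (PTree × ℕ) → ℕ → PTree → ℕ → Set
Segment xs g t e = Σ (List (PTree × ℕ)) λ A → Σ (List (PTree × ℕ)) λ B →
  (xs ≡ A ++ subtreesT e t ++ B) × (length A ≡ g)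

mutual
  segmentT : ∀ p t₀ g t e → nth (subtreesT p t₀) g ≡ just (t , e) → Segment (subtreesT p t₀) g t e
  segmentT p (node cs) zero    .(node cs) .p refl = [] , [] , sym (LP.++-identityʳ _) , refl
  segmentT p (node cs) (suc g) t e eq with segmentF (suc p) cs g t e eq
  ... | A , B , split , refl = (node cs , p) ∷ A , B , cong ((node cs , p) ∷_) split , refl

  segmentF : ∀ p cs g t e → nth (subtreesF p cs) g ≡ just (t , e) → Segment (subtreesF p cs) g t e
  segmentF p (t₀ ∷ ts) g t e eq with index-split (length (subtreesT p t₀)) g
  ... | inj₁ g<t₀ with segmentT p t₀ g t e (trans (sym (nth-++ˡ (subtreesT p t₀) (subtreesF p ts) g g<t₀)) eq)
  ...   | A , B , split , refl = A , B ++ subtreesF p ts , regroup , refl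
    where
    regroup : subtreesT p t₀ ++ subtreesF p ts ≡ A ++ subtreesT e t ++ B ++ subtreesF p ts
    regroup rewrite split | LP.++-assoc A (subtreesT e t ++ B) (subtreesF p ts)
                          | LP.++-assoc (subtreesT e t) B (subtreesF p ts) = refl
  segmentF p (t₀ ∷ ts) g t e eq | inj₂ (k , refl)
    with segmentF p ts k t e (trans (sym (nth-++ʳ (subtreesT p t₀) (subtreesF p ts) k)) eq)
  ... | A , B , split , refl =
    subtreesT p t₀ ++ A , B ,
    trans (cong (subtreesT p t₀ ++_) split) (sym (LP.++-assoc (subtreesT p t₀) A _)) ,
    LP.length-++ (subtreesT p t₀)

SplitAt : List Step → ℕ → PTree → Set
SplitAt w g t = Σ (List Step) λ α → Σ (List Step) λ β → (w ≡ α ++ wordT t ++ β) × (size α ≡ g)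

mutual
  splitAtT : ∀ p t₀ g t e → nth (subtreesT p t₀) g ≡ just (t , e) → SplitAt (wordT t₀) g t
  splitAtT p (node cs) zero    .(node cs) .p refl = [] , [] , sym (LP.++-identityʳ _) , refl
  splitAtT p (node cs) (suc g) t e eq with splitAtF (suc p) cs g t e eq
  ... | α , β , split , refl = u ∷ α , β ++ d ∷ [] , cong (u ∷_) regroup , refl
    where
    regroup : wordF cs ++ d ∷ [] ≡ α ++ wordT t ++ β ++ d ∷ []
    regroup rewrite split | LP.++-assoc α (wordT t ++ β) (d ∷ []) | LP.++-assoc (wordT t) β (d ∷ []) = refl

  splitAtF : ∀ p cs g t e → nth (subtreesF p cs) g ≡ just (t , e) → SplitAt (wordF cs) g t
  splitAtF p (t₀ ∷ ts) g t e eq with index-split (length (subtreesT p t₀)) g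
  ... | inj₁ g<t₀ with splitAtT p t₀ g t e (trans (sym (nth-++ˡ (subtreesT p t₀) (subtreesF p ts) g g<t₀)) eq)
  ...   | α , β , split , refl = α , β ++ wordF ts , regroup , refl
    where
    regroup : wordT t₀ ++ wordF ts ≡ α ++ wordT t ++ β ++ wordF ts
    regroup rewrite split | LP.++-assoc α (wordT t ++ β) (wordF ts) | LP.++-assoc (wordT t) β (wordF ts) = refl
  splitAtF p (t₀ ∷ ts) g t e eq | inj₂ (k , refl)
    with splitAtF p ts k t e (trans (sym (nth-++ʳ (subtreesT p t₀) (subtreesF p ts) k)) eq)
  ... | α , β , split , refl =
    wordT t₀ ++ α , β ,
    trans (cong (wordT t₀ ++_) split) (sym (LP.++-assoc (wordT t₀) α (wordT t ++ β))) ,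
    trans (size-++ (wordT t₀) α) (cong (_+ size α) (trans (size-wordT t₀) (sym (length-subtreesT p t₀))))

-- Subtree sizes read off a Dyck path

upsBeforeExit : ℕ → List Step → ℕ
upsBeforeExit h       []      = 0
upsBeforeExit h       (u ∷ w) = suc (upsBeforeExit (suc h) w)
upsBeforeExit zero    (d ∷ w) = 0
upsBeforeExit (suc h) (d ∷ w) = upsBeforeExit h w

fromUp : ℕ → List Step → List Step
fromUp k       []      = []
fromUp k       (d ∷ w) = fromUp k w
fromUp zero    (u ∷ w) = u ∷ w
fromUp (suc k) (u ∷ w) = fromUp k w

leadingSubtreeSize : List Step → ℕ
leadingSubtreeSize (u ∷ w) = suc (upsBeforeExit 0 w)
leadingSubtreeSize _       = 0

subtreeSize : List Step → ℕ → ℕ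
subtreeSize w g = leadingSubtreeSize (fromUp g w)

fromUp-++ : ∀ α v k → fromUp (size α + k) (α ++ v) ≡ fromUp k v
fromUp-++ []      v k = refl
fromUp-++ (u ∷ α) v k = fromUp-++ α v k
fromUp-++ (d ∷ α) v k = fromUp-++ α v k

mutual
  upsBeforeExit-wordT : ∀ h t r → upsBeforeExit h (wordT t ++ r) ≡ sizeT t + upsBeforeExit h r
  upsBeforeExit-wordT h (node cs) r =
    cong suc (trans (cong (upsBeforeExit (suc h)) (LP.++-assoc (wordF cs) (d ∷ []) r)) (upsBeforeExit-wordF (suc h) cs (d ∷ r)))

  upsBeforeExit-wordF : ∀ h cs r → upsBeforeExit h (wordF cs ++ r) ≡ sizeF cs + upsBeforeExit h r
  upsBeforeExit-wordF h []       r = refl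
  upsBeforeExit-wordF h (t ∷ ts) r = begin
    upsBeforeExit h ((wordT t ++ wordF ts) ++ r)  ≡⟨ cong (upsBeforeExit h) (LP.++-assoc (wordT t) (wordF ts) r) ⟩
    upsBeforeExit h (wordT t ++ wordF ts ++ r)    ≡⟨ upsBeforeExit-wordT h t (wordF ts ++ r) ⟩
    sizeT t + upsBeforeExit h (wordF ts ++ r)     ≡⟨ cong (λ n → sizeT t + n) (upsBeforeExit-wordF h ts r) ⟩
    sizeT t + (sizeF ts + upsBeforeExit h r)      ≡⟨ sym (NP.+-assoc (sizeT t) (sizeF ts) _) ⟩
    sizeT t + sizeF ts + upsBeforeExit h r        ∎
    where open ≡-Reasoning

subtreeSize-split : ∀ α t β → subtreeSize (α ++ wordT t ++ β) (size α) ≡ sizeT t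
subtreeSize-split α (node cs) β = begin
  subtreeSize w (size α)                             ≡⟨ cong (subtreeSize w) (sym (NP.+-identityʳ (size α))) ⟩
  leadingSubtreeSize (fromUp (size α + 0) w)         ≡⟨ cong leadingSubtreeSize (fromUp-++ α (wordT (node cs) ++ β) 0) ⟩
  suc (upsBeforeExit 0 ((wordF cs ++ d ∷ []) ++ β))  ≡⟨ cong (λ v → suc (upsBeforeExit 0 v)) (LP.++-assoc (wordF cs) (d ∷ []) β) ⟩
  suc (upsBeforeExit 0 (wordF cs ++ d ∷ β))          ≡⟨ cong suc (upsBeforeExit-wordF 0 cs (d ∷ β)) ⟩
  suc (sizeF cs + 0)                                 ≡⟨ cong suc (NP.+-identityʳ (sizeF cs)) ⟩
  sizeT (node cs)                                    ∎
  where
  open ≡-Reasoning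
  w = α ++ wordT (node cs) ++ β

subtreeSize-at : ∀ cs f t e → nth (subtreesF 0 cs) f ≡ just (t , e) → subtreeSize (wordF cs) f ≡ sizeT t
subtreeSize-at cs f t e eq with splitAtF 0 cs f t e eq
... | α , β , split , refl rewrite split = subtreeSize-split α t β

record Excursion (w : List Step) (f : ℕ) : Set where
  field
    start end    : ℕ
    starts-up    : nth w start ≡ just u
    ups-start    : ups w start ≡ f
    ups-end      : ups w end ≡ f + subtreeSize w f
    start<end    : start < end
    end≤length   : end ≤ length w
    returns      : level w end ≡ level w start
    above-inside : ∀ t → start < t → t < end → level w start < level w t

level-offset : ∀ {a b m} z → + a ≡ z +ℤ 0ℤ → + b ≡ z +ℤ + m → b ≡ a + m
level-offset {m = m} z za zb =
  ZP.+-injective (trans zb (cong (_+ℤ + m) (trans (sym (ZP.+-identityʳ z)) (sym za))))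

excursion-split : ∀ α t β → NonNegative (α ++ wordT t ++ β) → Excursion (α ++ wordT t ++ β) (size α)
excursion-split α (node cs) β w≥0 = record
  { start        = L
  ; end          = L + n
  ; starts-up    = nth-length-++ α u _
  ; ups-start    = cong size (take-length-++ α v)
  ; ups-end      = trans (cong size (trans (take-++ʳ α v n) (cong (α ++_) (take-length-++ t β))))
                         (trans (size-++ α t) (cong (λ n → size α + n) (trans (size-wordT (node cs))
                                                                 (sym (subtreeSize-split α (node cs) β)))))
  ; start<end    = NP.m<m+n L (NP.<-≤-trans (s≤s z≤n) (length-wordT≥2 (node cs)))
  ; end≤length   = subst (L + n ≤_) (sym (trans (LP.length-++ α) (cong (λ m → L + m) (LP.length-++ t))))
                         (NP.+-monoʳ-≤ L (NP.m≤m+n n (length β)))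
  ; returns      = trans (level-offset (height α) level-start level-end) (NP.+-identityʳ _)
  ; above-inside = inside
  }
  where
  t = wordT (node cs)
  v = t ++ β
  w = α ++ v
  L = length α
  n = length t
  level-at : ∀ j → + level w (L + j) ≡ height α +ℤ heightAt v j
  level-at j = trans (level-height w w≥0 (L + j)) (heightAt-++ α v j)
  level-start : + level w L ≡ height α +ℤ 0ℤ
  level-start = subst (λ k → + level w k ≡ height α +ℤ 0ℤ) (NP.+-identityʳ L) (level-at 0)
  level-end : + level w (L + n) ≡ height α +ℤ + 0
  level-end = trans (level-at n) (cong (height α +ℤ_) (trans (cong height (take-length-++ t β)) (height-wordT (node cs))))
  inside : ∀ s → L < s → s < L + n → level w L < level w s
  inside s L<s s<end with index-split L s
  ... | inj₁ s<L = ⊥-elim (NP.<-asym L<s s<L)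
  ... | inj₂ (j , refl) with wordT-positive (node cs) j (NP.+-cancelˡ-< L 0 j (subst (_< L + j) (sym (NP.+-identityʳ L)) L<s))
                                                     (NP.+-cancelˡ-< L j n s<end)
  ... | m , positive = subst (level w L <_) (sym (level-offset (height α) level-start level-s)) (NP.m<m+n _ (s≤s z≤n))
    where
    level-s : + level w (L + j) ≡ height α +ℤ + suc m
    level-s = trans (level-at j) (cong (height α +ℤ_) (trans (cong height (take-++ˡ t β j (NP.<⇒≤ (NP.+-cancelˡ-< L j n s<end)))) positive))

excursion-at : ∀ cs f → f < sizeF cs → Excursion (wordF cs) f
excursion-at cs f f<cs with subtreesF-lookup cs f f<cs
... | (t , e) , eq with splitAtF 0 cs f t e eq
... | α , β , split , refl rewrite split = excursion-split α t β (subst NonNegative split (wordF-nonneg cs))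

-- Subtree sizes increase along the Tamari order

upsBeforeExit-swap : ∀ h X cs r → upsBeforeExit h (X ++ d ∷ wordF cs ++ r) ≤ upsBeforeExit h (X ++ wordF cs ++ d ∷ r)
upsBeforeExit-swap zero    []      cs r = z≤n
upsBeforeExit-swap (suc h) []      cs r rewrite upsBeforeExit-wordF h cs r | upsBeforeExit-wordF (suc h) cs (d ∷ r) = NP.≤-refl
upsBeforeExit-swap h       (u ∷ X) cs r = s≤s (upsBeforeExit-swap (suc h) X cs r)
upsBeforeExit-swap zero    (d ∷ X) cs r = z≤n
upsBeforeExit-swap (suc h) (d ∷ X) cs r = upsBeforeExit-swap h X cs r

fromUp-++ˡ : ∀ A g r → g < size A → fromUp g (A ++ r) ≡ fromUp g A ++ r
fromUp-++ˡ (u ∷ A) zero    r _         = refl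
fromUp-++ˡ (u ∷ A) (suc g) r (s≤s g<A) = fromUp-++ˡ A g r g<A
fromUp-++ˡ (d ∷ A) g       r g<A       = fromUp-++ˡ A g r g<A

fromUp-up : ∀ A g → g < size A → Σ (List Step) λ X → fromUp g A ≡ u ∷ X
fromUp-up (u ∷ A) zero    _         = A , refl
fromUp-up (u ∷ A) (suc g) (s≤s g<A) = fromUp-up A g g<A
fromUp-up (d ∷ A) g       g<A       = fromUp-up A g g<A

subtreeSize-inside : ∀ cs k r r′ → k < sizeF cs → subtreeSize (wordF cs ++ r) k ≡ subtreeSize (wordF cs ++ r′) k
subtreeSize-inside cs k r r′ k<cs with subtreesF-lookup cs k k<cs
... | (t , e) , eq with splitAtF 0 cs k t e eq
... | α , β , split , refl = trans (followed-by r) (sym (followed-by r′))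
  where
  followed-by : ∀ r → subtreeSize (wordF cs ++ r) (size α) ≡ sizeT t
  followed-by r rewrite split | LP.++-assoc α (wordT t ++ β) r | LP.++-assoc (wordT t) β r = subtreeSize-split α t (β ++ r)

-- Only the excursions that start before the rotated factor change, and they
-- can only get longer.
subtreeSize-rotate : ∀ A cs C g → subtreeSize (A ++ d ∷ wordF cs ++ C) g ≤ subtreeSize (A ++ wordF cs ++ d ∷ C) g
subtreeSize-rotate A cs C g with index-split (size A) g
... | inj₁ g<A with fromUp-up A g g<A
... | X , from-g
  rewrite fromUp-++ˡ A g (d ∷ wordF cs ++ C) g<A | fromUp-++ˡ A g (wordF cs ++ d ∷ C) g<A | from-g
  = s≤s (upsBeforeExit-swap 0 X cs C)
subtreeSize-rotate A cs C g | inj₂ (k , refl)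
  rewrite fromUp-++ A (d ∷ wordF cs ++ C) k | fromUp-++ A (wordF cs ++ d ∷ C) k
  with index-split (sizeF cs) k
... | inj₁ k<cs = NP.≤-reflexive (subtreeSize-inside cs k C (d ∷ C) k<cs)
... | inj₂ (k′ , refl) = NP.≤-reflexive (trans (past C) (sym (past (d ∷ C))))
  where
  past : ∀ r → leadingSubtreeSize (fromUp (sizeF cs + k′) (wordF cs ++ r)) ≡ leadingSubtreeSize (fromUp k′ r)
  past r = cong leadingSubtreeSize
    (trans (cong (λ m → fromUp (m + k′) (wordF cs ++ r)) (sym (size-wordF cs))) (fromUp-++ (wordF cs) r k′))

subtreeSize-cover : ∀ P Q → Covers P Q → ∀ g → subtreeSize P g ≤ subtreeSize Q g
subtreeSize-cover _ _ (cover A B C prim) g with dyck⇒wordF (u ∷ B ++ d ∷ []) (proj₁ prim)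
... | cs , U≡cs = subst (λ U → subtreeSize (A ++ d ∷ U ++ C) g ≤ subtreeSize (A ++ U ++ d ∷ C) g) U≡cs
                        (subtreeSize-rotate A cs C g)

subtreeSize-tamari : ∀ P Q → P ≤T Q → ∀ g → subtreeSize P g ≤ subtreeSize Q g
subtreeSize-tamari P .P ε                 g = NP.≤-refl
subtreeSize-tamari P Q  (P⋖P′ ◅ P′≤Q) g = NP.≤-trans (subtreeSize-cover _ _ P⋖P′ g) (subtreeSize-tamari _ Q P′≤Q g)

-- Leaf masks: which edges in traversal order end in a leaf

mutual
  leafMaskT : PTree → List Bool
  leafMaskT (node [])       = true ∷ []
  leafMaskT (node (c ∷ cs)) = false ∷ leafMaskF (c ∷ cs)

  leafMaskF : List PTree → List Bool
  leafMaskF []       = []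
  leafMaskF (t ∷ ts) = leafMaskT t ++ leafMaskF ts

isLeaf : PTree → Bool
isLeaf (node [])      = true
isLeaf (node (_ ∷ _)) = false

isLeafEntry : PTree × ℕ → Bool
isLeafEntry x = isLeaf (proj₁ x)

mutual
  leafMaskT-subtrees : ∀ p t → leafMaskT t ≡ map isLeafEntry (subtreesT p t)
  leafMaskT-subtrees p (node [])       = refl
  leafMaskT-subtrees p (node (c ∷ cs)) = cong (false ∷_) (leafMaskF-subtrees (suc p) (c ∷ cs))

  leafMaskF-subtrees : ∀ p ts → leafMaskF ts ≡ map isLeafEntry (subtreesF p ts)
  leafMaskF-subtrees p []       = refl
  leafMaskF-subtrees p (t ∷ ts) =
    trans (cong₂ _++_ (leafMaskT-subtrees p t) (leafMaskF-subtrees p ts)) (sym (LP.map-++ _ (subtreesT p t) (subtreesF p ts)))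

mutual
  length-leafMaskT : ∀ t → length (leafMaskT t) ≡ sizeT t
  length-leafMaskT (node [])       = refl
  length-leafMaskT (node (c ∷ cs)) = cong suc (length-leafMaskF (c ∷ cs))

  length-leafMaskF : ∀ ts → length (leafMaskF ts) ≡ sizeF ts
  length-leafMaskF []       = refl
  length-leafMaskF (t ∷ ts) = trans (LP.length-++ (leafMaskT t)) (cong₂ _+_ (length-leafMaskT t) (length-leafMaskF ts))

mutual
  leafMaskT-last : ∀ t → Σ (List Bool) λ ys → leafMaskT t ≡ ys ++ true ∷ []
  leafMaskT-last (node [])       = [] , refl
  leafMaskT-last (node (c ∷ cs)) with leafMaskF-last c cs
  ... | ys , eq = false ∷ ys , cong (false ∷_) eq

  leafMaskF-last : ∀ t ts → Σ (List Bool) λ ys → leafMaskF (t ∷ ts) ≡ ys ++ true ∷ []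
  leafMaskF-last t [] with leafMaskT-last t
  ... | ys , eq = ys , trans (LP.++-identityʳ (leafMaskT t)) eq
  leafMaskF-last t (t′ ∷ ts) with leafMaskF-last t′ ts
  ... | ys , eq = leafMaskT t ++ ys , trans (cong (leafMaskT t ++_) eq) (sym (LP.++-assoc (leafMaskT t) ys _))

leafMask-at : ∀ cs f t e → nth (subtreesF 0 cs) f ≡ just (t , e) → nth (leafMaskF cs) f ≡ just (isLeaf t)
leafMask-at cs f t e eq =
  trans (cong (λ bs → nth bs f) (leafMaskF-subtrees 0 cs)) (trans (nth-map _ (subtreesF 0 cs) f) (cong (Data.Maybe.map _) eq))

leafMask-index< : ∀ cs m {b} → nth (leafMaskF cs) m ≡ just b → m < sizeF cs
leafMask-index< cs m eq = subst (m <_) (length-leafMaskF cs) (nth-just-< (leafMaskF cs) m eq)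

leafMask-segment : ∀ cs f t e → nth (subtreesF 0 cs) f ≡ just (t , e) → ∀ j → j < sizeT t →
                   nth (leafMaskF cs) (f + j) ≡ nth (leafMaskT t) j
leafMask-segment cs f t e eq j j<t with segmentF 0 cs f t e eq
... | A , B , split , refl = begin
  nth (leafMaskF cs) (length A + j)
    ≡⟨ cong (λ bs → nth bs (length A + j)) (trans (leafMaskF-subtrees 0 cs) (cong (map isLeafEntry) split)) ⟩
  nth (map isLeafEntry (A ++ subtreesT e t ++ B)) (length A + j)
    ≡⟨ nth-map isLeafEntry (A ++ subtreesT e t ++ B) (length A + j) ⟩
  Data.Maybe.map isLeafEntry (nth (A ++ subtreesT e t ++ B) (length A + j))
    ≡⟨ cong (Data.Maybe.map isLeafEntry) (trans (nth-++ʳ A _ j) (nth-++ˡ (subtreesT e t) B j j<e)) ⟩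
  Data.Maybe.map isLeafEntry (nth (subtreesT e t) j)
    ≡⟨ sym (nth-map isLeafEntry (subtreesT e t) j) ⟩
  nth (map isLeafEntry (subtreesT e t)) j
    ≡⟨ cong (λ bs → nth bs j) (sym (leafMaskT-subtrees e t)) ⟩
  nth (leafMaskT t) j
    ∎
  where
  open ≡-Reasoning
  j<e : j < length (subtreesT e t)
  j<e = subst (j <_) (sym (length-subtreesT e t)) j<t

subtreeSize-leaf : ∀ cs m → nth (leafMaskF cs) m ≡ just true → subtreeSize (wordF cs) m ≡ 1
subtreeSize-leaf cs m is-leaf with subtreesF-lookup cs m (leafMask-index< cs m is-leaf)
... | (node []      , e) , eq = subtreeSize-at cs m (node []) e eq
... | (node (_ ∷ _) , e) , eq with trans (sym (leafMask-at cs m _ e eq)) is-leaf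
... | ()

subtreeSize-internal : ∀ cs m → nth (leafMaskF cs) m ≡ just false → Σ ℕ λ a → subtreeSize (wordF cs) m ≡ suc (suc a)
subtreeSize-internal cs m is-internal with subtreesF-lookup cs m (leafMask-index< cs m is-internal)
... | (node [] , e) , eq with trans (sym (leafMask-at cs m _ e eq)) is-internal
... | ()
subtreeSize-internal cs m is-internal | (node (node c ∷ cs′) , e) , eq = sizeF c + sizeF cs′ , subtreeSize-at cs m _ e eq

letterOf : Bool → Letter
letterOf true  = N
letterOf false = E

letterOf-injective : ∀ {a b} → letterOf a ≡ letterOf b → a ≡ b
letterOf-injective {true}  {true}  _ = refl
letterOf-injective {false} {false} _ = refl
letterOf-injective {true}  {false} ()
letterOf-injective {false} {true}  ()

mutual
  upLetters-wordT : ∀ t r → upLetters (wordT t ++ r) ≡ map letterOf (leafMaskT t) ++ upLetters r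
  upLetters-wordT (node [])              r = refl
  upLetters-wordT (node (node c ∷ cs)) r =
    cong (E ∷_) (trans (cong upLetters (LP.++-assoc (wordF (node c ∷ cs)) (d ∷ []) r)) (upLetters-wordF (node c ∷ cs) (d ∷ r)))

  upLetters-wordF : ∀ cs r → upLetters (wordF cs ++ r) ≡ map letterOf (leafMaskF cs) ++ upLetters r
  upLetters-wordF []       r = refl
  upLetters-wordF (t ∷ ts) r = begin
    upLetters ((wordT t ++ wordF ts) ++ r)                                 ≡⟨ cong upLetters (LP.++-assoc (wordT t) (wordF ts) r) ⟩
    upLetters (wordT t ++ wordF ts ++ r)                                   ≡⟨ upLetters-wordT t (wordF ts ++ r) ⟩
    map letterOf (leafMaskT t) ++ upLetters (wordF ts ++ r)                ≡⟨ cong (map letterOf (leafMaskT t) ++_) (upLetters-wordF ts r) ⟩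
    map letterOf (leafMaskT t) ++ map letterOf (leafMaskF ts) ++ upLetters r ≡⟨ sym (LP.++-assoc (map letterOf (leafMaskT t)) _ _) ⟩
    (map letterOf (leafMaskT t) ++ map letterOf (leafMaskF ts)) ++ upLetters r ≡⟨ cong (_++ upLetters r) (sym (LP.map-++ letterOf (leafMaskT t) (leafMaskF ts))) ⟩
    map letterOf (leafMaskT t ++ leafMaskF ts) ++ upLetters r              ∎
    where open ≡-Reasoning

upLetters≡leafMask : ∀ cs → upLetters (wordF cs) ≡ map letterOf (leafMaskF cs)
upLetters≡leafMask cs = trans (cong upLetters (sym (LP.++-identityʳ (wordF cs)))) (trans (upLetters-wordF cs []) (LP.++-identityʳ _))

dropLast-snoc : ∀ (ys : List A) y → dropLast (ys ++ y ∷ []) ≡ ys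
dropLast-snoc []            y = refl
dropLast-snoc (x ∷ [])      y = refl
dropLast-snoc (x ∷ x′ ∷ ys) y = cong (x ∷_) (dropLast-snoc (x′ ∷ ys) y)

Type-wordF : ∀ t ts → Σ (List Bool) λ ys → (leafMaskF (t ∷ ts) ≡ ys ++ true ∷ []) × (Type (wordF (t ∷ ts)) ≡ map letterOf ys)
Type-wordF t ts with leafMaskF-last t ts
... | ys , mask = ys , mask , (begin
  dropLast (upLetters (wordF (t ∷ ts)))        ≡⟨ cong dropLast (upLetters≡leafMask (t ∷ ts)) ⟩
  dropLast (map letterOf (leafMaskF (t ∷ ts))) ≡⟨ cong (λ bs → dropLast (map letterOf bs)) mask ⟩
  dropLast (map letterOf (ys ++ true ∷ []))    ≡⟨ cong dropLast (LP.map-++ letterOf ys (true ∷ [])) ⟩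
  dropLast (map letterOf ys ++ N ∷ [])         ≡⟨ dropLast-snoc (map letterOf ys) N ⟩
  map letterOf ys                              ∎)
  where open ≡-Reasoning

Type⇒leafMask : ∀ csP csQ → 1 ≤ sizeF csP → 1 ≤ sizeF csQ → Type (wordF csP) ≡ Type (wordF csQ) → leafMaskF csP ≡ leafMaskF csQ
Type⇒leafMask [] _ () _ _
Type⇒leafMask (_ ∷ _) [] _ () _
Type⇒leafMask (t ∷ ts) (t′ ∷ ts′) _ _ same-type with Type-wordF t ts | Type-wordF t′ ts′
... | ys , maskP , typeP | ys′ , maskQ , typeQ =
  trans maskP (trans (cong (_++ true ∷ []) (LP.map-injective letterOf-injective (trans (sym typeP) (trans same-type typeQ)))) (sym maskQ))

-- Up steps, descents and levels of a Dyck path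

step-cases : ∀ w t → t < length w → nth w t ≡ just u ⊎ nth w t ≡ just d
step-cases w t t<w with nth-just w t t<w
... | u , eq = inj₁ eq
... | d , eq = inj₂ eq

upPositions-nth : ∀ m w k → k < size w →
  Σ ℕ λ p → nth (upPositionsFrom m w) k ≡ just (m + p) × nth w p ≡ just u × ups w p ≡ k
upPositions-nth m (u ∷ w) zero    _         = 0 , cong just (sym (NP.+-identityʳ m)) , refl , refl
upPositions-nth m (u ∷ w) (suc k) (s≤s k<w) with upPositions-nth (suc m) w k k<w
... | p , at , up , ups-p = suc p , trans at (cong just (sym (NP.+-suc m p))) , up , cong suc ups-p
upPositions-nth m (d ∷ w) k       k<w       with upPositions-nth (suc m) w k k<w
... | p , at , up , ups-p = suc p , trans at (cong just (sym (NP.+-suc m p))) , up , ups-p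

ups-reflects-< : ∀ w {a b} → ups w a < ups w b → a < b
ups-reflects-< w {a} {b} ups< with NP.<-cmp a b
... | tri< a<b _ _ = a<b
... | tri≈ _ refl _ = ⊥-elim (NP.<-irrefl refl ups<)
... | tri> _ _ b<a = ⊥-elim (NP.<⇒≱ ups< (ups-mono w (NP.<⇒≤ b<a)))

upPosition-unique : ∀ w {q q′} → nth w q ≡ just u → nth w q′ ≡ just u → ups w q ≡ ups w q′ → q ≡ q′
upPosition-unique w {q} {q′} up up′ same with NP.<-cmp q q′
... | tri< q<q′ _ _ = ⊥-elim (NP.<-irrefl same (NP.≤-trans (NP.≤-reflexive (sym (ups-up w q up))) (ups-mono w q<q′)))
... | tri≈ _ q≡q′ _ = q≡q′
... | tri> _ _ q′<q = ⊥-elim (NP.<-irrefl (sym same) (NP.≤-trans (NP.≤-reflexive (sym (ups-up w q′ up′))) (ups-mono w q′<q)))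

nth-drop : ∀ (w : List A) n j → nth (drop n w) j ≡ nth w (n + j)
nth-drop w       zero    j       = refl
nth-drop []      (suc n) zero    = refl
nth-drop []      (suc n) (suc j) = refl
nth-drop (x ∷ w) (suc n) j       = nth-drop w n j

drop′≡drop : ∀ n w → drop' n w ≡ drop n w
drop′≡drop zero    w       = refl
drop′≡drop (suc n) []      = refl
drop′≡drop (suc n) (s ∷ w) = drop′≡drop n w

nth-drop′ : ∀ w n j → nth (drop' n w) j ≡ nth w (n + j)
nth-drop′ w n j = trans (cong (λ v → nth v j) (drop′≡drop n w)) (nth-drop w n j)

downRun-down : ∀ v j → j < downRun v → nth v j ≡ just d
downRun-down (d ∷ v) zero    _         = refl
downRun-down (d ∷ v) (suc j) (s≤s j<v) = downRun-down v j j<v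

downRun-positive : ∀ v → nth v 0 ≡ just d → 1 ≤ downRun v
downRun-positive (d ∷ v) _ = s≤s z≤n

downRun-maximal : ∀ v → nth v (downRun v) ≢ just d
downRun-maximal (d ∷ v) eq = downRun-maximal v eq
downRun-maximal (u ∷ v) ()
downRun-maximal []      ()

descent-down : ∀ P p t → suc p ≤ t → t < lowestAfter P p → nth P t ≡ just d
descent-down P p t p<t t<x =
  subst (λ s → nth P s ≡ just d) p+j≡t
        (trans (sym (nth-drop′ P (suc p) j)) (downRun-down (drop' (suc p) P) j j<run))
  where
  j = t ∸ suc p
  p+j≡t : suc p + j ≡ t
  p+j≡t = NP.m+[n∸m]≡n p<t
  j<run : j < downRun (drop' (suc p) P)
  j<run = NP.+-cancelˡ-< (suc p) _ _ (subst (_< lowestAfter P p) (sym p+j≡t) t<x)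

descent-maximal : ∀ P p → nth P (lowestAfter P p) ≢ just d
descent-maximal P p eq = downRun-maximal (drop' (suc p) P) (trans (nth-drop′ P (suc p) _) eq)

descent-lowers : ∀ w → NonNegative w → ∀ t t′ → t ≤ t′ → (∀ i → t ≤ i → i < t′ → nth w i ≡ just d) →
                 level w t′ ≤ level w t × ups w t′ ≡ ups w t
descent-lowers w w≥0 t t′ t≤t′ down =
  subst (λ s → level w s ≤ level w t × ups w s ≡ ups w t) (NP.m+[n∸m]≡n t≤t′)
        (by (t′ ∸ t) (λ i t≤i i<t+k → down i t≤i (subst (i <_) (NP.m+[n∸m]≡n t≤t′) i<t+k)))
  where
  by : ∀ k → (∀ i → t ≤ i → i < t + k → nth w i ≡ just d) → level w (t + k) ≤ level w t × ups w (t + k) ≡ ups w t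
  by zero    _    = NP.≤-reflexive (cong (level w) (NP.+-identityʳ t)) , cong (ups w) (NP.+-identityʳ t)
  by (suc k) down with by k (λ i t≤i i<t+k → down i t≤i (NP.≤-trans i<t+k (NP.+-monoʳ-≤ t (NP.n≤1+n k))))
  ... | lower , same =
    subst (λ s → level w s ≤ level w t) (sym (NP.+-suc t k))
          (NP.≤-trans (NP.≤-trans (NP.n≤1+n _) (NP.≤-reflexive (sym (level-down w w≥0 (t + k) step)))) lower) ,
    trans (cong (ups w) (NP.+-suc t k)) (trans (ups-down w (t + k) step) same)
    where
    step : nth w (t + k) ≡ just d
    step = down (t + k) (NP.m≤m+n t k) (subst (t + k <_) (sym (NP.+-suc t k)) NP.≤-refl)

<⇒≡suc : ∀ {m n} → m < n → Σ ℕ λ h → n ≡ suc h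
<⇒≡suc {n = suc h} _ = h , refl

last-below : ∀ (Pr : ℕ → Set) → (∀ t → Dec (Pr t)) → ∀ x → Pr 0 → ¬ Pr x →
             Σ ℕ λ a → a < x × Pr a × (∀ t → a < t → t ≤ x → ¬ Pr t)
last-below Pr Pr? zero    P0 ¬Px = ⊥-elim (¬Px P0)
last-below Pr Pr? (suc x) P0 ¬Px with Pr? x
... | yes Px = x , NP.≤-refl , Px , λ t x<t t≤1+x → subst (λ s → ¬ Pr s) (NP.≤-antisym x<t t≤1+x) ¬Px
... | no ¬Px′ with last-below Pr Pr? x P0 ¬Px′
... | a , a<x , Pa , none = a , NP.≤-trans a<x (NP.n≤1+n x) , Pa , none′
  where
  none′ : ∀ t → a < t → t ≤ suc x → ¬ Pr t
  none′ t a<t t≤1+x with NP.m≤n⇒m<n∨m≡n t≤1+x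
  ... | inj₁ (s≤s t≤x) = none t a<t t≤x
  ... | inj₂ refl      = ¬Px

doubleUp⇒∈ : ∀ k w a → nth w a ≡ just u → nth w (suc a) ≡ just u → k + suc a ∈ doubleUpsFrom k w
doubleUp⇒∈ k (u ∷ u ∷ w) zero    _  _  = here (NP.+-comm k 1)
doubleUp⇒∈ k (u ∷ u ∷ w) (suc a) up up′ =
  there (subst (_∈ doubleUpsFrom (suc k) (u ∷ w)) (sym (NP.+-suc k (suc a))) (doubleUp⇒∈ (suc k) (u ∷ w) a up up′))
doubleUp⇒∈ k (u ∷ d ∷ w) (suc a) up up′ =
  subst (_∈ doubleUpsFrom (suc k) (d ∷ w)) (sym (NP.+-suc k (suc a))) (doubleUp⇒∈ (suc k) (d ∷ w) a up up′)
doubleUp⇒∈ k (d ∷ w)     (suc a) up up′ =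
  subst (_∈ doubleUpsFrom (suc k) w) (sym (NP.+-suc k (suc a))) (doubleUp⇒∈ (suc k) w a up up′)
doubleUp⇒∈ k (u ∷ [])    zero    _  ()
doubleUp⇒∈ k (u ∷ [])    (suc a) _  ()
doubleUp⇒∈ k (u ∷ d ∷ w) zero    _  ()
doubleUp⇒∈ k (d ∷ w)     zero    () _

∈⇒doubleUp : ∀ k w y → y ∈ doubleUpsFrom k w →
             Σ ℕ λ j → y ≡ k + suc j × nth w j ≡ just u × nth w (suc j) ≡ just u
∈⇒doubleUp k (u ∷ u ∷ w) y (here refl) = 0 , NP.+-comm 1 k , refl , refl
∈⇒doubleUp k (u ∷ u ∷ w) y (there y∈) with ∈⇒doubleUp (suc k) (u ∷ w) y y∈
... | j , refl , up , up′ = suc j , sym (NP.+-suc k (suc j)) , up , up′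
∈⇒doubleUp k (u ∷ d ∷ w) y y∈ with ∈⇒doubleUp (suc k) (d ∷ w) y y∈
... | j , refl , up , up′ = suc j , sym (NP.+-suc k (suc j)) , up , up′
∈⇒doubleUp k (d ∷ w)     y y∈ with ∈⇒doubleUp (suc k) w y y∈
... | j , refl , up , up′ = suc j , sym (NP.+-suc k (suc j)) , up , up′

weaken-head : ∀ {k xs} → AllPairs _<_ (suc k ∷ xs) → AllPairs _<_ (k ∷ xs)
weaken-head (k<xs ∷ xs↑) = All.map (NP.<-trans (NP.n<1+n _)) k<xs ∷ xs↑

doubleUps-increasing : ∀ k w → AllPairs _<_ (k ∷ doubleUpsFrom k w)
doubleUps-increasing k []          = [] ∷ []
doubleUps-increasing k (u ∷ [])    = [] ∷ []
doubleUps-increasing k (u ∷ u ∷ w) with doubleUps-increasing (suc k) (u ∷ w)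
... | k+1<xs ∷ xs↑ = (NP.n<1+n k ∷ All.map (NP.<-trans (NP.n<1+n k)) k+1<xs) ∷ k+1<xs ∷ xs↑
doubleUps-increasing k (u ∷ d ∷ w) = weaken-head (doubleUps-increasing (suc k) (d ∷ w))
doubleUps-increasing k (d ∷ w)     = weaken-head (doubleUps-increasing (suc k) w)

filterᵇ-none : ∀ (pr : ℕ → Bool) xs → (∀ y → y ∈ xs → pr y ≡ false) → filterᵇ pr xs ≡ []
filterᵇ-none pr []       none = refl
filterᵇ-none pr (y ∷ ys) none rewrite none y (here refl) = filterᵇ-none pr ys (λ z z∈ → none z (there z∈))

last-∷ : ∀ (y : ℕ) zs k → last zs ≡ just k → last (y ∷ zs) ≡ just k
last-∷ y (z ∷ zs) k eq = eq

last-filterᵇ : ∀ (pr : ℕ → Bool) xs k → AllPairs _<_ xs → k ∈ xs → pr k ≡ true →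
               (∀ y → y ∈ xs → pr y ≡ true → y ≤ k) → last (filterᵇ pr xs) ≡ just k
last-filterᵇ pr (y ∷ ys) k (y<ys ∷ _) (here refl) pk largest rewrite pk =
  cong (λ zs → last (k ∷ zs)) (filterᵇ-none pr ys none)
  where
  none : ∀ z → z ∈ ys → pr z ≡ false
  none z z∈ with pr z in pz
  ... | false = refl
  ... | true  = ⊥-elim (NP.<⇒≱ (All.lookup y<ys z∈) (largest z (there z∈) pz))
last-filterᵇ pr (y ∷ ys) k (_ ∷ ys↑) (there k∈) pk largest with pr y
... | true  = last-∷ y (filterᵇ pr ys) k (last-filterᵇ pr ys k ys↑ k∈ pk (λ z z∈ → largest z (there z∈)))
... | false = last-filterᵇ pr ys k ys↑ k∈ pk (λ z z∈ → largest z (there z∈))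

-- Leaf labels of R([P,Q]) in terms of the excursions of P

module LeafLabels (P : List Step) (P≥0 : NonNegative P) (excursion : ∀ f → f < size P → Excursion P f)
                  (depths : List ℕ) (depth : ℕ → ℕ) (depth-nth : ∀ g → g < size P → nth depths g ≡ just (depth g)) where

  open Excursion

  H : ℕ → ℕ
  H = level P

  rayTarget : ℕ → ℕ → Bool
  rayTarget x k = (k <ᵇ x) ∧ does (heightAt P k Z.≟ heightAt P x)

  rayTarget-true : ∀ x k → k < x → H k ≡ H x → rayTarget x k ≡ true
  rayTarget-true x k k<x same with k <ᵇ x | NP.<⇒<ᵇ k<x
  ... | true | _ = dec-true (heightAt P k Z.≟ heightAt P x)
                     (trans (sym (level-height P P≥0 k)) (trans (cong +_ same) (level-height P P≥0 x)))

  rayTarget-true⁻ : ∀ x k → rayTarget x k ≡ true → k < x × H k ≡ H x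
  rayTarget-true⁻ x k hit with k <ᵇ x in k<ᵇx | heightAt P k Z.≟ heightAt P x
  rayTarget-true⁻ x k hit | true  | yes same =
    NP.<ᵇ⇒< k x (subst T (sym k<ᵇx) tt) , ZP.+-injective (trans (level-height P P≥0 k) (trans same (sym (level-height P P≥0 x))))
  rayTarget-true⁻ x k ()  | true  | no _
  rayTarget-true⁻ x k ()  | false | _

  ups<size : ∀ a → nth P a ≡ just u → ups P a < size P
  ups<size a up = NP.≤-trans (NP.≤-reflexive (sym (ups-up P a up))) (ups≤size P (suc a))

  record Peak (k : ℕ) : Set where
    field
      top            : ℕ
      top-at         : nth (upPositionsFrom 0 P) k ≡ just top
      top-up         : nth P top ≡ just u
      ups-top        : ups P top ≡ k
      bottom         : ℕ
      bottom-def     : bottom ≡ lowestAfter P top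
      top<bottom     : suc top < bottom
      descends       : ∀ t → suc top ≤ t → t < bottom → nth P t ≡ just d
      bottom≤length  : bottom ≤ length P
      bottom-maximal : nth P bottom ≢ just d
      ups-bottom     : ups P bottom ≡ suc k

  open Peak

  peakOf : ∀ k → k < size P → subtreeSize P k ≡ 1 → Peak k
  peakOf k k<P is-leaf with upPositions-nth 0 P k k<P
  ... | p , at , up , ups-p = record
    { top = p ; top-at = at ; top-up = up ; ups-top = ups-p
    ; bottom = lowestAfter P p ; bottom-def = refl ; top<bottom = p+1<x
    ; descends = descent-down P p ; bottom≤length = x≤length
    ; bottom-maximal = descent-maximal P p ; ups-bottom = ups-x
    }
    where
    ek = excursion k k<P
    start≡p : start ek ≡ p
    start≡p = upPosition-unique P (starts-up ek) up (trans (ups-start ek) (sym ups-p))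
    ups-end≡ : ups P (end ek) ≡ suc k
    ups-end≡ = trans (ups-end ek) (trans (cong (λ n → k + n) is-leaf) (NP.+-comm k 1))
    p+1<end : suc p < end ek
    p+1<end with NP.m≤n⇒m<n∨m≡n (subst (_< end ek) start≡p (start<end ek))
    ... | inj₁ p+1<end = p+1<end
    ... | inj₂ p+1≡end =
      ⊥-elim (NP.1+n≢n (trans (sym (level-up P P≥0 p up)) (trans (cong H p+1≡end) (trans (returns ek) (cong H start≡p)))))
    after-top : nth P (suc p) ≡ just d
    after-top with step-cases P (suc p) (NP.<-≤-trans p+1<end (end≤length ek))
    ... | inj₂ down = down
    ... | inj₁ up′  = ⊥-elim (NP.<⇒≱ two-ups (NP.≤-trans (ups-mono P p+1<end) (NP.≤-reflexive ups-end≡)))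
      where
      two-ups : suc k < ups P (suc (suc p))
      two-ups = NP.≤-reflexive (sym (trans (ups-up P (suc p) up′) (cong suc (trans (ups-up P p up) (cong suc ups-p)))))
    p+1<x : suc p < lowestAfter P p
    p+1<x = subst (_≤ lowestAfter P p) (NP.+-comm (suc p) 1) (NP.+-monoʳ-≤ (suc p)
      (downRun-positive (drop' (suc p) P) (trans (nth-drop′ P (suc p) 0) (trans (cong (nth P) (NP.+-identityʳ (suc p))) after-top))))
    x≤length : lowestAfter P p ≤ length P
    x≤length with lowestAfter P p | p+1<x | descent-down P p
    ... | suc x | s≤s p<x | down = nth-just-< P x (down x p<x NP.≤-refl)
    ups-x : ups P (lowestAfter P p) ≡ suc k
    ups-x = trans (proj₂ (descent-lowers P P≥0 (suc p) (lowestAfter P p) (NP.<⇒≤ p+1<x) (descent-down P p)))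
                       (trans (ups-up P p up) (cong suc ups-p))

  leafLabel-at : ∀ {k} (pk : Peak k) → leafLabel P depths k ≡ labelAux depths P (rayHit P (bottom pk))
  leafLabel-at pk rewrite top-at pk | bottom-def pk = refl

  rayHit-ground : ∀ x → H x ≡ 0 → rayHit P x ≡ nothing
  rayHit-ground x ground = cong last (filterᵇ-none (rayTarget x) (doubleUpsFrom 0 P) none)
    where
    none : ∀ y → y ∈ doubleUpsFrom 0 P → rayTarget x y ≡ false
    none y y∈ with rayTarget x y in hit
    ... | false = refl
    ... | true with ∈⇒doubleUp 0 P y y∈ | rayTarget-true⁻ x y hit
    ... | j , refl , up , _ | _ , same = ⊥-elim (NP.1+n≢0 (trans (sym (level-up P P≥0 j up)) (trans same ground)))

  leafLabel-ground : ∀ {k} (pk : Peak k) → H (bottom pk) ≡ 0 → leafLabel P depths k ≡ -[1+ 0 ]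
  leafLabel-ground pk ground = trans (leafLabel-at pk) (cong (labelAux depths P) (rayHit-ground (bottom pk) ground))

  record Ray (x h : ℕ) : Set where
    field
      foot       : ℕ
      foot<x     : foot < x
      foot-up    : nth P foot ≡ just u
      foot-level : H foot ≡ h
      higher     : ∀ t → foot < t → t ≤ x → h < H t
      hits       : rayHit P x ≡ just (suc foot)

  ray : ∀ x h → H (suc x) ≡ suc h → nth P x ≡ just d → suc x ≤ length P → Ray (suc x) h
  ray x h level-x down x<P
    with last-below (λ t → H t ≤ h) (λ t → H t N.≤? h) (suc x) z≤n (λ ≤h → NP.1+n≰n (subst (_≤ h) level-x ≤h))
  ... | a , a<x , a≤h , none = record
    { foot = a ; foot<x = a<x ; foot-up = a-up ; foot-level = a-level ; higher = higher ; hits = hits }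
    where
    higher : ∀ t → a < t → t ≤ suc x → h < H t
    higher t a<t t≤x = NP.≰⇒> (none t a<t t≤x)
    a-up : nth P a ≡ just u
    a-up with step-cases P a (NP.≤-trans a<x x<P)
    ... | inj₁ up    = up
    ... | inj₂ down′ = ⊥-elim (NP.<⇒≱ (higher (suc a) NP.≤-refl a<x)
                        (NP.≤-trans (NP.n≤1+n _) (NP.≤-trans (NP.≤-reflexive (sym (level-down P P≥0 a down′))) a≤h)))
    a-level : H a ≡ h
    a-level = NP.≤-antisym a≤h (NP.≤-pred (subst (h <_) (level-up P P≥0 a a-up) (higher (suc a) NP.≤-refl a<x)))
    a+1<x : suc a < suc x
    a+1<x with NP.m≤n⇒m<n∨m≡n a<x
    ... | inj₁ a+1<x = a+1<x
    ... | inj₂ refl  = case trans (sym a-up) down of λ ()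
    a+1-up : nth P (suc a) ≡ just u
    a+1-up with step-cases P (suc a) (NP.≤-trans a+1<x x<P)
    ... | inj₁ up    = up
    ... | inj₂ down′ = ⊥-elim (NP.<-irrefl (sym level-a+2) (higher (suc (suc a)) (NP.n≤1+n (suc a)) a+1<x))
      where
      level-a+2 : H (suc (suc a)) ≡ h
      level-a+2 = NP.suc-injective (trans (sym (level-down P P≥0 (suc a) down′)) (trans (level-up P P≥0 a a-up) (cong suc a-level)))
    latest : ∀ y → y ∈ doubleUpsFrom 0 P → rayTarget (suc x) y ≡ true → y ≤ suc a
    latest y y∈ target with ∈⇒doubleUp 0 P y y∈ | rayTarget-true⁻ (suc x) y target
    ... | j , refl , j-up , _ | j+1<x , same with NP.<-cmp a j
    ...   | tri< a<j _ _ = ⊥-elim (NP.<-irrefl (sym level-j) (higher j a<j (NP.≤-trans (NP.n≤1+n j) (NP.<⇒≤ j+1<x))))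
      where
      level-j : H j ≡ h
      level-j = NP.suc-injective (trans (sym (level-up P P≥0 j j-up)) (trans same level-x))
    ...   | tri≈ _ refl _ = NP.≤-refl
    ...   | tri> _ _ j<a  = s≤s (NP.<⇒≤ j<a)
    hits : rayHit P (suc x) ≡ just (suc a)
    hits = last-filterᵇ (rayTarget (suc x)) (doubleUpsFrom 0 P) (suc a) (AllPairs.tail (doubleUps-increasing 0 P)) (doubleUp⇒∈ 0 P a a-up a+1-up)
             (rayTarget-true (suc x) (suc a) a+1<x (trans (level-up P P≥0 a a-up) (trans (cong suc a-level) (sym level-x))))
             latest

  rayFromBottom : ∀ {k} (pk : Peak k) h → H (bottom pk) ≡ suc h → Ray (bottom pk) h
  rayFromBottom pk h with bottom pk | top<bottom pk | descends pk | bottom≤length pk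
  ... | suc x | s≤s p<x | down | x<P = λ level-x → ray x h level-x (down x p<x NP.≤-refl) x<P

  leafLabel-hit : ∀ {k} (pk : Peak k) {h} (r : Ray (bottom pk) h) → leafLabel P depths k ≡ + depth (ups P (Ray.foot r))
  leafLabel-hit pk r = begin
    leafLabel P depths _                        ≡⟨ leafLabel-at pk ⟩
    labelAux depths P (rayHit P (bottom pk))    ≡⟨ cong (labelAux depths P) (Ray.hits r) ⟩
    labelAux depths P (just (suc (Ray.foot r))) ≡⟨ labelAux-just (suc (Ray.foot r)) (depth-nth _ (ups<size _ (Ray.foot-up r))) ⟩
    + depth (ups P (Ray.foot r))                ∎
    where
    open ≡-Reasoning
    labelAux-just : ∀ k {v} → nth depths (size (take (k ∸ 1) P)) ≡ just v → labelAux depths P (just k) ≡ + v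
    labelAux-just k at rewrite at = refl

  leafLabel-inner : ∀ f k → k < size P → subtreeSize P k ≡ 1 → f < k → suc k < f + subtreeSize P f →
                    Σ ℕ λ g → f ≤ g × g < f + subtreeSize P f × leafLabel P depths k ≡ + depth g
  leafLabel-inner f k k<P is-leaf f<k k+1<end = ups P foot , f≤g , g<end , leafLabel-hit pk r
    where
    pk = peakOf k k<P is-leaf
    ef = excursion f (NP.<-trans f<k k<P)
    start<top : start ef < top pk
    start<top = ups-reflects-< P (subst₂ _<_ (sym (ups-start ef)) (sym (ups-top pk)) f<k)
    start<bottom : start ef < bottom pk
    start<bottom = NP.<-trans start<top (NP.<-trans (NP.n<1+n _) (top<bottom pk))
    bottom<end : bottom pk < end ef
    bottom<end = ups-reflects-< P (subst₂ _<_ (sym (ups-bottom pk)) (sym (ups-end ef)) k+1<end)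
    above-start : H (start ef) < H (bottom pk)
    above-start = above-inside ef (bottom pk) start<bottom bottom<end
    h = proj₁ (<⇒≡suc above-start)
    r : Ray (bottom pk) h
    r = rayFromBottom pk h (proj₂ (<⇒≡suc above-start))
    open Ray r
    start≤foot : start ef ≤ foot
    start≤foot = NP.≮⇒≥ λ foot<start →
      NP.<⇒≱ (higher (start ef) foot<start (NP.<⇒≤ start<bottom)) (NP.≤-pred (subst (H (start ef) <_) (proj₂ (<⇒≡suc above-start)) above-start))
    f≤g : f ≤ ups P foot
    f≤g = subst (_≤ ups P foot) (ups-start ef) (ups-mono P start≤foot)
    g<end : ups P foot < f + subtreeSize P f
    g<end = NP.≤-trans (NP.≤-reflexive (sym (ups-up P foot foot-up)))
                       (NP.≤-trans (ups-mono P (NP.≤-trans foot<x (NP.<⇒≤ bottom<end))) (NP.≤-reflexive (ups-end ef)))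

  leafLabel-closing-hit : ∀ {f k} (pk : Peak k) (ef : Excursion P f) → start ef < bottom pk →
    (∀ t → start ef ≤ t → t ≤ bottom pk → H (bottom pk) ≤ H t) → ∀ h → H (bottom pk) ≡ suc h →
    Σ ℕ λ g → g < f × f < g + subtreeSize P g × leafLabel P depths k ≡ + depth g
  leafLabel-closing-hit {f} pk ef start<bottom lowest h level-bottom = ups P foot , g<f , f<end , leafLabel-hit pk r
    where
    r = rayFromBottom pk h level-bottom
    open Ray r
    foot<start : foot < start ef
    foot<start = NP.≰⇒> λ start≤foot →
      NP.1+n≰n (subst₂ _≤_ level-bottom foot-level (lowest foot start≤foot (NP.<⇒≤ foot<x)))
    g<f : ups P foot < f
    g<f = NP.≤-trans (NP.≤-reflexive (sym (ups-up P foot foot-up))) (subst (ups P (suc foot) ≤_) (ups-start ef) (ups-mono P foot<start))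
    eg = excursion (ups P foot) (ups<size foot foot-up)
    start≡foot : start eg ≡ foot
    start≡foot = upPosition-unique P (starts-up eg) foot-up (ups-start eg)
    bottom<end : bottom pk < end eg
    bottom<end = NP.≰⇒> λ end≤bottom →
      NP.<-irrefl (sym (trans (returns eg) (trans (cong H start≡foot) foot-level)))
                  (higher (end eg) (subst (_< end eg) start≡foot (start<end eg)) end≤bottom)
    f<end : f < ups P foot + subtreeSize P (ups P foot)
    f<end = NP.≤-trans (NP.≤-reflexive (trans (cong suc (sym (ups-start ef))) (sym (ups-up P (start ef) (starts-up ef)))))
                       (NP.≤-trans (ups-mono P (NP.≤-trans start<bottom (NP.<⇒≤ bottom<end))) (NP.≤-reflexive (ups-end eg)))

  leafLabel-closing : ∀ f k → k < size P → subtreeSize P k ≡ 1 → f < k → suc k ≡ f + subtreeSize P f →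
    leafLabel P depths k ≡ -[1+ 0 ] ⊎ Σ ℕ λ g → g < f × f < g + subtreeSize P g × leafLabel P depths k ≡ + depth g
  leafLabel-closing f k k<P is-leaf f<k k+1≡end = by-level (H (bottom pk)) refl
    where
    pk = peakOf k k<P is-leaf
    ef = excursion f (NP.<-trans f<k k<P)
    start<bottom : start ef < bottom pk
    start<bottom = NP.<-trans (ups-reflects-< P (subst₂ _<_ (sym (ups-start ef)) (sym (ups-top pk)) f<k))
                              (NP.<-trans (NP.n<1+n _) (top<bottom pk))
    ups-end≡ : ups P (end ef) ≡ suc k
    ups-end≡ = trans (ups-end ef) (sym k+1≡end)
    top<end : top pk < end ef
    top<end = ups-reflects-< P (subst₂ _<_ (sym (ups-top pk)) (sym ups-end≡) NP.≤-refl)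
    end≤bottom : end ef ≤ bottom pk
    end≤bottom = NP.≮⇒≥ λ bottom<end → case step-cases P (bottom pk) (NP.≤-trans bottom<end (end≤length ef)) of λ where
      (inj₂ down) → bottom-maximal pk down
      (inj₁ up)   → NP.1+n≰n (subst₂ _≤_ (trans (ups-up P (bottom pk) up) (cong suc (ups-bottom pk))) ups-end≡ (ups-mono P bottom<end))
    descent-above : ∀ t → suc (top pk) ≤ t → t ≤ bottom pk → H (bottom pk) ≤ H t
    descent-above t p<t t≤x =
      proj₁ (descent-lowers P P≥0 t (bottom pk) t≤x (λ i t≤i i<x → descends pk i (NP.≤-trans p<t t≤i) i<x))
    below-start : H (bottom pk) ≤ H (start ef)
    below-start = NP.≤-trans (descent-above (end ef) top<end end≤bottom) (NP.≤-reflexive (returns ef))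
    lowest : ∀ t → start ef ≤ t → t ≤ bottom pk → H (bottom pk) ≤ H t
    lowest t start≤t t≤x with NP.<-cmp t (end ef)
    ... | tri> _ _ end<t = descent-above t (NP.≤-trans top<end (NP.<⇒≤ end<t)) t≤x
    ... | tri≈ _ refl _  = descent-above t top<end t≤x
    ... | tri< t<end _ _ with NP.m≤n⇒m<n∨m≡n start≤t
    ...   | inj₂ refl    = below-start
    ...   | inj₁ start<t = NP.≤-trans below-start (NP.<⇒≤ (above-inside ef t start<t t<end))
    by-level : ∀ n → H (bottom pk) ≡ n →
      leafLabel P depths k ≡ -[1+ 0 ] ⊎ Σ ℕ λ g → g < f × f < g + subtreeSize P g × leafLabel P depths k ≡ + depth g
    by-level zero    ground       = inj₁ (leafLabel-ground pk ground)
    by-level (suc h) level-bottom = inj₂ (leafLabel-closing-hit pk ef start<bottom lowest h level-bottom)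

-- Leaves and the labelled tree

-- leavesT i t: traversal indices of the leaves of t, where i is the index of
-- the edge above t.
mutual
  leavesT : ℕ → PTree → List ℕ
  leavesT i (node [])       = i ∷ []
  leavesT i (node (c ∷ cs)) = leavesF (suc i) (c ∷ cs)

  leavesF : ℕ → List PTree → List ℕ
  leavesF i []       = []
  leavesF i (t ∷ ts) = leavesT i t ++ leavesF (i + sizeT t) ts

labelF-cons : ∀ f i t ts → labelF f i (t ∷ ts) ≡
  (proj₁ (labelT f i t) ∷ proj₁ (labelF f (proj₂ (labelT f i t)) ts) , proj₂ (labelF f (proj₂ (labelT f i t)) ts))
labelF-cons f i t ts with labelT f i t
... | t′ , j with labelF f j ts
... | ts′ , k = refl

labelT-node : ∀ f i c cs → labelT f i (node (c ∷ cs)) ≡ (inner (proj₁ (labelF f (suc i) (c ∷ cs))) , proj₂ (labelF f (suc i) (c ∷ cs)))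
labelT-node f i c cs with labelF f (suc i) (c ∷ cs)
... | cs′ , j = refl

mutual
  counter-labelT : ∀ f i t → proj₂ (labelT f i t) ≡ i + sizeT t
  counter-labelT f i (node [])       = NP.+-comm 1 i
  counter-labelT f i (node (c ∷ cs)) =
    trans (cong proj₂ (labelT-node f i c cs)) (trans (counter-labelF f (suc i) (c ∷ cs)) (sym (NP.+-suc i _)))

  counter-labelF : ∀ f i ts → proj₂ (labelF f i ts) ≡ i + sizeF ts
  counter-labelF f i []       = sym (NP.+-identityʳ i)
  counter-labelF f i (t ∷ ts) = begin
    proj₂ (labelF f i (t ∷ ts))                   ≡⟨ cong proj₂ (labelF-cons f i t ts) ⟩
    proj₂ (labelF f (proj₂ (labelT f i t)) ts)    ≡⟨ cong (λ j → proj₂ (labelF f j ts)) (counter-labelT f i t) ⟩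
    proj₂ (labelF f (i + sizeT t) ts)             ≡⟨ counter-labelF f (i + sizeT t) ts ⟩
    i + sizeT t + sizeF ts                        ≡⟨ NP.+-assoc i (sizeT t) (sizeF ts) ⟩
    i + (sizeT t + sizeF ts)                      ∎
    where open ≡-Reasoning

mutual
  contourT-labelT : ∀ f i t → contourT (proj₁ (labelT f i t)) ≡ wordT t
  contourT-labelT f i (node [])       = refl
  contourT-labelT f i (node (c ∷ cs)) =
    trans (cong (λ r → contourT (proj₁ r)) (labelT-node f i c cs)) (cong (λ w → u ∷ w ++ d ∷ []) (contourF-labelF f (suc i) (c ∷ cs)))

  contourF-labelF : ∀ f i ts → contourF (proj₁ (labelF f i ts)) ≡ wordF ts
  contourF-labelF f i []       = refl
  contourF-labelF f i (t ∷ ts) =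
    trans (cong (λ r → contourF (proj₁ r)) (labelF-cons f i t ts)) (cong₂ _++_ (contourT-labelT f i t) (contourF-labelF f _ ts))

mutual
  shapeT-labelT : ∀ f i t → shapeT (proj₁ (labelT f i t)) ≡ leafMaskT t
  shapeT-labelT f i (node [])       = refl
  shapeT-labelT f i (node (c ∷ cs)) =
    trans (cong (λ r → shapeT (proj₁ r)) (labelT-node f i c cs)) (cong (false ∷_) (shapeF-labelF f (suc i) (c ∷ cs)))

  shapeF-labelF : ∀ f i ts → shapeF (proj₁ (labelF f i ts)) ≡ leafMaskF ts
  shapeF-labelF f i []       = refl
  shapeF-labelF f i (t ∷ ts) =
    trans (cong (λ r → shapeF (proj₁ r)) (labelF-cons f i t ts)) (cong₂ _++_ (shapeT-labelT f i t) (shapeF-labelF f _ ts))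

allPairs-split : ∀ pre z post → AllPairs _<_ (pre ++ z ∷ post) → (∀ m → m ∈ pre → m < z) × (∀ m → m ∈ post → z < m)
allPairs-split []        z post (z<post ∷ _) = (λ m ()) , λ m m∈ → All.lookup z<post m∈
allPairs-split (x ∷ pre) z post (x<rest ∷ rest↑) with allPairs-split pre z post rest↑
... | before , after = before′ , after
  where
  before′ : ∀ m → m ∈ x ∷ pre → m < z
  before′ m (here refl) = All.lookup x<rest (∈-++⁺ʳ pre (here refl))
  before′ m (there m∈)  = before m m∈

mutual
  leaves-rangeT : ∀ i t m → m ∈ leavesT i t → i ≤ m × m < i + sizeT t
  leaves-rangeT i (node [])       m (here refl) = NP.≤-refl , subst (i <_) (NP.+-comm 1 i) NP.≤-refl
  leaves-rangeT i (node (c ∷ cs)) m m∈ with leaves-rangeF (suc i) (c ∷ cs) m m∈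
  ... | i<m , m<end = NP.≤-trans (NP.n≤1+n i) i<m , subst (m <_) (sym (NP.+-suc i _)) m<end

  leaves-rangeF : ∀ i ts m → m ∈ leavesF i ts → i ≤ m × m < i + sizeF ts
  leaves-rangeF i (t ∷ ts) m m∈ with ∈-++⁻ (leavesT i t) m∈
  ... | inj₁ m∈t with leaves-rangeT i t m m∈t
  ...   | i≤m , m<end = i≤m , NP.<-≤-trans m<end (NP.+-monoʳ-≤ i (NP.m≤m+n (sizeT t) (sizeF ts)))
  leaves-rangeF i (t ∷ ts) m m∈ | inj₂ m∈ts with leaves-rangeF (i + sizeT t) ts m m∈ts
  ... | j≤m , m<end = NP.≤-trans (NP.m≤m+n i (sizeT t)) j≤m , subst (m <_) (NP.+-assoc i (sizeT t) (sizeF ts)) m<end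

mutual
  leavesT-increasing : ∀ i t → AllPairs _<_ (leavesT i t)
  leavesT-increasing i (node [])       = [] ∷ []
  leavesT-increasing i (node (c ∷ cs)) = leavesF-increasing (suc i) (c ∷ cs)

  leavesF-increasing : ∀ i ts → AllPairs _<_ (leavesF i ts)
  leavesF-increasing i []       = []
  leavesF-increasing i (t ∷ ts) = AllPairsP.++⁺ (leavesT-increasing i t) (leavesF-increasing (i + sizeT t) ts)
    (All.tabulate λ a∈ → All.tabulate λ b∈ → NP.<-≤-trans (proj₂ (leaves-rangeT i t _ a∈)) (proj₁ (leaves-rangeF (i + sizeT t) ts _ b∈)))

mutual
  leavesT-last : ∀ i t → Σ (List ℕ) λ init → leavesT i t ≡ init ++ (i + sizeT t ∸ 1) ∷ []
  leavesT-last i (node [])       = [] , cong (λ n → n ∸ 1 ∷ []) (sym (NP.+-comm i 1))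
  leavesT-last i (node (c ∷ cs)) with leavesF-last (suc i) c cs
  ... | init , split = init , trans split (cong (λ n → init ++ n ∸ 1 ∷ []) (sym (NP.+-suc i _)))

  leavesF-last : ∀ i t ts → Σ (List ℕ) λ init → leavesF i (t ∷ ts) ≡ init ++ (i + sizeF (t ∷ ts) ∸ 1) ∷ []
  leavesF-last i t [] with leavesT-last i t
  ... | init , split = init , trans (LP.++-identityʳ _) (trans split (cong (λ n → init ++ i + n ∸ 1 ∷ []) (sym (NP.+-identityʳ (sizeT t)))))
  leavesF-last i t (t′ ∷ ts) with leavesF-last (i + sizeT t) t′ ts
  ... | init , split = leavesT i t ++ init ,
    trans (cong (leavesT i t ++_) split)
          (trans (sym (LP.++-assoc (leavesT i t) init _)) (cong (λ n → (leavesT i t ++ init) ++ n ∸ 1 ∷ []) (NP.+-assoc i (sizeT t) _)))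

leavesOfMask : ℕ → List Bool → List ℕ
leavesOfMask i []           = []
leavesOfMask i (true  ∷ bs) = i ∷ leavesOfMask (suc i) bs
leavesOfMask i (false ∷ bs) = leavesOfMask (suc i) bs

leavesOfMask-++ : ∀ i bs bs′ → leavesOfMask i (bs ++ bs′) ≡ leavesOfMask i bs ++ leavesOfMask (i + length bs) bs′
leavesOfMask-++ i []           bs′ = cong (λ j → leavesOfMask j bs′) (sym (NP.+-identityʳ i))
leavesOfMask-++ i (true  ∷ bs) bs′ =
  cong (i ∷_) (trans (leavesOfMask-++ (suc i) bs bs′) (cong (λ j → leavesOfMask (suc i) bs ++ leavesOfMask j bs′) (sym (NP.+-suc i _))))
leavesOfMask-++ i (false ∷ bs) bs′ =
  trans (leavesOfMask-++ (suc i) bs bs′) (cong (λ j → leavesOfMask (suc i) bs ++ leavesOfMask j bs′) (sym (NP.+-suc i _)))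

mutual
  leavesT-leavesOfMask : ∀ i t → leavesT i t ≡ leavesOfMask i (leafMaskT t)
  leavesT-leavesOfMask i (node [])       = refl
  leavesT-leavesOfMask i (node (c ∷ cs)) = leavesF-leavesOfMask (suc i) (c ∷ cs)

  leavesF-leavesOfMask : ∀ i ts → leavesF i ts ≡ leavesOfMask i (leafMaskF ts)
  leavesF-leavesOfMask i []       = refl
  leavesF-leavesOfMask i (t ∷ ts) =
    trans (cong₂ _++_ (leavesT-leavesOfMask i t)
                      (trans (leavesF-leavesOfMask (i + sizeT t) ts) (cong (λ n → leavesOfMask (i + n) (leafMaskF ts)) (sym (length-leafMaskT t)))))
          (sym (leavesOfMask-++ i (leafMaskT t) (leafMaskF ts)))

∈-leavesOfMask : ∀ i bs m → m ∈ leavesOfMask i bs → Σ ℕ λ j → m ≡ i + j × nth bs j ≡ just true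
∈-leavesOfMask i (true  ∷ bs) m (here refl) = 0 , sym (NP.+-identityʳ i) , refl
∈-leavesOfMask i (true  ∷ bs) m (there m∈) with ∈-leavesOfMask (suc i) bs m m∈
... | j , refl , is-leaf = suc j , sym (NP.+-suc i j) , is-leaf
∈-leavesOfMask i (false ∷ bs) m m∈ with ∈-leavesOfMask (suc i) bs m m∈
... | j , refl , is-leaf = suc j , sym (NP.+-suc i j) , is-leaf

leavesOfMask-∈ : ∀ i bs j → nth bs j ≡ just true → i + j ∈ leavesOfMask i bs
leavesOfMask-∈ i (true  ∷ bs) zero    _    = here (NP.+-identityʳ i)
leavesOfMask-∈ i (true  ∷ bs) (suc j) is-leaf = there (subst (_∈ leavesOfMask (suc i) bs) (sym (NP.+-suc i j)) (leavesOfMask-∈ (suc i) bs j is-leaf))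
leavesOfMask-∈ i (false ∷ bs) (suc j) is-leaf = subst (_∈ leavesOfMask (suc i) bs) (sym (NP.+-suc i j)) (leavesOfMask-∈ (suc i) bs j is-leaf)

countTrue : List Bool → ℕ
countTrue []           = 0
countTrue (true  ∷ bs) = suc (countTrue bs)
countTrue (false ∷ bs) = countTrue bs

countTrue-++ : ∀ bs bs′ → countTrue (bs ++ bs′) ≡ countTrue bs + countTrue bs′
countTrue-++ []           bs′ = refl
countTrue-++ (true  ∷ bs) bs′ = cong suc (countTrue-++ bs bs′)
countTrue-++ (false ∷ bs) bs′ = countTrue-++ bs bs′

mutual
  countTrue-leafMaskT : ∀ i t → countTrue (leafMaskT t) ≡ length (leavesT i t)
  countTrue-leafMaskT i (node [])       = refl
  countTrue-leafMaskT i (node (c ∷ cs)) = countTrue-leafMaskF (suc i) (c ∷ cs)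

  countTrue-leafMaskF : ∀ i ts → countTrue (leafMaskF ts) ≡ length (leavesF i ts)
  countTrue-leafMaskF i []       = refl
  countTrue-leafMaskF i (t ∷ ts) =
    trans (countTrue-++ (leafMaskT t) (leafMaskF ts))
          (trans (cong₂ _+_ (countTrue-leafMaskT i t) (countTrue-leafMaskF (i + sizeT t) ts)) (sym (LP.length-++ (leavesT i t))))

emit-++ : ∀ bs bs′ ks ks′ → countTrue bs ≡ length ks → emit (bs ++ bs′) (ks ++ ks′) ≡ emit bs ks ++ emit bs′ ks′
emit-++ []           bs′ []       ks′ _     = refl
emit-++ (false ∷ bs) bs′ ks       ks′ count = cong (u ∷_) (emit-++ bs bs′ ks ks′ count)
emit-++ (true  ∷ bs) bs′ (k ∷ ks) ks′ count =
  cong (u ∷_) (trans (cong (replicate (suc k) d ++_) (emit-++ bs bs′ ks ks′ (NP.suc-injective count)))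
                     (sym (LP.++-assoc (replicate (suc k) d) _ _)))

replicate-snoc : ∀ n → replicate n d ++ d ∷ [] ≡ d ∷ replicate n d
replicate-snoc zero    = refl
replicate-snoc (suc n) = cong (d ∷_) (replicate-snoc n)

-- Charges and P(T)

indicator : ℕ → ℕ → ℕ
indicator a m = if does (a N.≟ m) then 1 else 0

indicator-≢ : ∀ a m → a ≢ m → indicator a m ≡ 0
indicator-≢ a m a≢m rewrite dec-false (a N.≟ m) a≢m = refl

indicator-refl : ∀ a → indicator a a ≡ 1
indicator-refl a rewrite dec-true (a N.≟ a) refl = refl

threshold : ℕ → ℤ
threshold p = + p -ℤ + 2

map-cong-∈ : ∀ {B : Set} (g g′ : ℕ → B) xs → (∀ m → m ∈ xs → g m ≡ g′ m) → map g xs ≡ map g′ xs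
map-cong-∈ g g′ []       same = refl
map-cong-∈ g g′ (x ∷ xs) same = cong₂ _∷_ (same x (here refl)) (map-cong-∈ g g′ xs (λ m m∈ → same m (there m∈)))

-- EveryInternalF Ψ p i ts: Ψ p′ j cs holds for every internal vertex of ts,
-- where j is the index of the edge above it, p′ its depth and cs its children.
mutual
  EveryInternalT : (ℕ → ℕ → List PTree → Set) → ℕ → ℕ → PTree → Set
  EveryInternalT Ψ p i (node [])       = ⊤
  EveryInternalT Ψ p i (node (c ∷ cs)) = Ψ p i (c ∷ cs) × EveryInternalF Ψ (suc p) (suc i) (c ∷ cs)

  EveryInternalF : (ℕ → ℕ → List PTree → Set) → ℕ → ℕ → List PTree → Set
  EveryInternalF Ψ p i []       = ⊤
  EveryInternalF Ψ p i (t ∷ ts) = EveryInternalT Ψ p i t × EveryInternalF Ψ p (i + sizeT t) ts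

-- The internal vertex below edge i gives its charge to the leaf with index ℓ i.
module ChargeCounts (ℓ : ℕ → ℕ) (ℓ-ge : ∀ g → g ≤ ℓ g) where

  chargeCount : List Bool → ℕ → ℕ → ℕ
  chargeCount []           i m = 0
  chargeCount (true  ∷ bs) i m = chargeCount bs (suc i) m
  chargeCount (false ∷ bs) i m = indicator (ℓ i) m + chargeCount bs (suc i) m

  chargeCount-++ : ∀ bs bs′ i m → chargeCount (bs ++ bs′) i m ≡ chargeCount bs i m + chargeCount bs′ (i + length bs) m
  chargeCount-++ []           bs′ i m = cong (λ j → chargeCount bs′ j m) (sym (NP.+-identityʳ i))
  chargeCount-++ (true  ∷ bs) bs′ i m =
    trans (chargeCount-++ bs bs′ (suc i) m) (cong (λ j → chargeCount bs (suc i) m + chargeCount bs′ j m) (sym (NP.+-suc i _)))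
  chargeCount-++ (false ∷ bs) bs′ i m =
    trans (cong (λ n → indicator (ℓ i) m + n)
                (trans (chargeCount-++ bs bs′ (suc i) m) (cong (λ j → chargeCount bs (suc i) m + chargeCount bs′ j m) (sym (NP.+-suc i _)))))
          (sym (NP.+-assoc (indicator (ℓ i) m) _ _))

  chargeCount-below : ∀ bs i m → m < i → chargeCount bs i m ≡ 0
  chargeCount-below []           i m m<i = refl
  chargeCount-below (true  ∷ bs) i m m<i = chargeCount-below bs (suc i) m (NP.≤-trans m<i (NP.n≤1+n i))
  chargeCount-below (false ∷ bs) i m m<i =
    cong₂ _+_ (indicator-≢ (ℓ i) m (λ ℓi≡m → NP.<⇒≱ m<i (subst (i ≤_) ℓi≡m (ℓ-ge i))))
              (chargeCount-below bs (suc i) m (NP.≤-trans m<i (NP.n≤1+n i)))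

  chargeCount-++ˡ : ∀ i t ts m → m ∈ leavesT i t → chargeCount (leafMaskT t ++ leafMaskF ts) i m ≡ chargeCount (leafMaskT t) i m
  chargeCount-++ˡ i t ts m m∈ =
    trans (chargeCount-++ (leafMaskT t) (leafMaskF ts) i m)
          (trans (cong (λ n → chargeCount (leafMaskT t) i m + n) (chargeCount-below (leafMaskF ts) _ m m<end)) (NP.+-identityʳ _))
    where
    m<end : m < i + length (leafMaskT t)
    m<end = subst (λ n → m < i + n) (sym (length-leafMaskT t)) (proj₂ (leaves-rangeT i t m m∈))

  -- If every internal vertex charges a leaf of its own subtree, leaves after a
  -- subtree receive nothing from it.
  module WithinSubtrees (Ψ : ℕ → ℕ → List PTree → Set) (Ψ⇒∈ : ∀ p i cs → Ψ p i cs → ℓ i ∈ leavesF (suc i) cs) where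

    mutual
      chargeCount-pastT : ∀ p i t → EveryInternalT Ψ p i t → ∀ m → i + sizeT t ≤ m → chargeCount (leafMaskT t) i m ≡ 0
      chargeCount-pastT p i (node [])       _        m end≤m = refl
      chargeCount-pastT p i (node (c ∷ cs)) (ψ , ψs) m end≤m =
        cong₂ _+_ (indicator-≢ (ℓ i) m (λ ℓi≡m → NP.<⇒≱ ℓi<end (subst (_ ≤_) (sym ℓi≡m) end≤m)))
                  (chargeCount-pastF (suc p) (suc i) (c ∷ cs) ψs m (subst (_≤ m) (NP.+-suc i _) end≤m))
        where
        ℓi<end : ℓ i < i + sizeT (node (c ∷ cs))
        ℓi<end = subst (ℓ i <_) (sym (NP.+-suc i _)) (proj₂ (leaves-rangeF (suc i) (c ∷ cs) (ℓ i) (Ψ⇒∈ p i (c ∷ cs) ψ)))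

      chargeCount-pastF : ∀ p i ts → EveryInternalF Ψ p i ts → ∀ m → i + sizeF ts ≤ m → chargeCount (leafMaskF ts) i m ≡ 0
      chargeCount-pastF p i []       _        m end≤m = refl
      chargeCount-pastF p i (t ∷ ts) (ψ , ψs) m end≤m = trans (chargeCount-++ (leafMaskT t) (leafMaskF ts) i m)
        (cong₂ _+_ (chargeCount-pastT p i t ψ m (NP.≤-trans (NP.+-monoʳ-≤ i (NP.m≤m+n (sizeT t) (sizeF ts))) end≤m))
                   (trans (cong (λ n → chargeCount (leafMaskF ts) (i + n) m) (length-leafMaskT t))
                          (chargeCount-pastF p (i + sizeT t) ts ψs m (subst (_≤ m) (sym (NP.+-assoc i (sizeT t) (sizeF ts))) end≤m))))

    chargeCount-++ʳ : ∀ p i t ts → EveryInternalT Ψ p i t → ∀ m → m ∈ leavesF (i + sizeT t) ts →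
                      chargeCount (leafMaskT t ++ leafMaskF ts) i m ≡ chargeCount (leafMaskF ts) (i + sizeT t) m
    chargeCount-++ʳ p i t ts ψ m m∈ =
      trans (chargeCount-++ (leafMaskT t) (leafMaskF ts) i m)
            (cong₂ _+_ (chargeCount-pastT p i t ψ m (proj₁ (leaves-rangeF (i + sizeT t) ts m m∈)))
                       (cong (λ n → chargeCount (leafMaskF ts) (i + n) m) (length-leafMaskT t)))

  charge-node : ∀ {B : Set} (G : ℕ → ℕ → B) i pre post (K : ℕ → ℕ) → AllPairs _<_ (pre ++ ℓ i ∷ post) →
    map (λ m → G m (indicator (ℓ i) m + K m)) (pre ++ ℓ i ∷ post) ≡
    map (λ m → G m (K m)) pre ++ G (ℓ i) (suc (K (ℓ i))) ∷ map (λ m → G m (K m)) post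
  charge-node G i pre post K increasing =
    trans (LP.map-++ _ pre (ℓ i ∷ post))
          (cong₂ _++_ (map-cong-∈ _ _ pre (λ m m∈ → cong (λ n → G m (n + K m)) (indicator-≢ (ℓ i) m (λ e → NP.<⇒≢ (proj₁ split m m∈) (sym e)))))
                      (cong₂ _∷_ (cong (λ n → G (ℓ i) (n + K (ℓ i))) (indicator-refl (ℓ i)))
                                 (map-cong-∈ _ _ post (λ m m∈ → cong (λ n → G m (n + K m)) (indicator-≢ (ℓ i) m (NP.<⇒≢ (proj₂ split m m∈)))))))
    where
    split = allPairs-split pre (ℓ i) post increasing

module LabelCharges (lab : ℕ → ℤ) (ℓ : ℕ → ℕ) (ℓ-ge : ∀ g → g ≤ ℓ g) where

  open ChargeCounts ℓ ℓ-ge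

  FirstLowLeaf : ℕ → ℕ → List PTree → Set
  FirstLowLeaf p i cs = Σ (List ℕ) λ pre → Σ (List ℕ) λ post →
    (leavesF (suc i) cs ≡ pre ++ ℓ i ∷ post) × (∀ m → m ∈ pre → ¬ (lab m ≤ℤ threshold p)) × (lab (ℓ i) ≤ℤ threshold p)

  firstLowLeaf-∈ : ∀ p i cs → FirstLowLeaf p i cs → ℓ i ∈ leavesF (suc i) cs
  firstLowLeaf-∈ p i cs (pre , post , split , _ , _) = subst (ℓ i ∈_) (sym split) (∈-++⁺ʳ pre (here refl))

  open WithinSubtrees FirstLowLeaf firstLowLeaf-∈

  bump-split : ∀ c (K : ℕ → ℕ) pre z post → (∀ m → m ∈ pre → ¬ (lab m ≤ℤ c)) → lab z ≤ℤ c →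
    bump c (map (λ m → (lab m , K m)) (pre ++ z ∷ post)) ≡ map (λ m → (lab m , K m)) pre ++ (lab z , suc (K z)) ∷ map (λ m → (lab m , K m)) post
  bump-split c K []        z post high low rewrite dec-true (lab z Z.≤? c) low = refl
  bump-split c K (x ∷ pre) z post high low rewrite dec-false (lab x Z.≤? c) (high x (here refl)) =
    cong ((lab x , K x) ∷_) (bump-split c K pre z post (λ m m∈ → high m (there m∈)) low)

  labelled : (ℕ → ℕ) → ℕ → ℤ × ℕ
  labelled K m = lab m , K m

  mutual
    chargesT-labelT : ∀ p i t → EveryInternalT FirstLowLeaf p i t →
      chargesT p (proj₁ (labelT lab i t)) ≡ map (labelled (chargeCount (leafMaskT t) i)) (leavesT i t)
    chargesT-labelT p i (node [])       _ = refl
    chargesT-labelT p i (node (c ∷ cs)) ((pre , post , split , high , low) , ψs) = begin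
      chargesT p (proj₁ (labelT lab i (node (c ∷ cs))))
        ≡⟨ cong (λ r → chargesT p (proj₁ r)) (labelT-node lab i c cs) ⟩
      bump (threshold p) (chargesF (suc p) (proj₁ (labelF lab (suc i) (c ∷ cs))))
        ≡⟨ cong (bump (threshold p)) (trans (chargesF-labelF (suc p) (suc i) (c ∷ cs) ψs) (cong (map (labelled K)) split)) ⟩
      bump (threshold p) (map (labelled K) (pre ++ ℓ i ∷ post))
        ≡⟨ bump-split (threshold p) K pre (ℓ i) post high low ⟩
      map (labelled K) pre ++ (lab (ℓ i) , suc (K (ℓ i))) ∷ map (labelled K) post
        ≡⟨ pair-up ⟩
      map (labelled K′) (pre ++ ℓ i ∷ post)
        ≡⟨ cong (map (labelled K′)) (sym split) ⟩
      map (labelled K′) (leavesF (suc i) (c ∷ cs))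
        ∎
      where
      open ≡-Reasoning
      K K′ : ℕ → ℕ
      K  = chargeCount (leafMaskF (c ∷ cs)) (suc i)
      K′ m = indicator (ℓ i) m + K m
      pair-up : map (labelled K) pre ++ (lab (ℓ i) , suc (K (ℓ i))) ∷ map (labelled K) post ≡ map (labelled K′) (pre ++ ℓ i ∷ post)
      pair-up = sym (charge-node (λ m n → lab m , n) i pre post K (subst (AllPairs _<_) split (leavesF-increasing (suc i) (c ∷ cs))))

    chargesF-labelF : ∀ p i ts → EveryInternalF FirstLowLeaf p i ts →
      chargesF p (proj₁ (labelF lab i ts)) ≡ map (labelled (chargeCount (leafMaskF ts) i)) (leavesF i ts)
    chargesF-labelF p i []       _        = refl
    chargesF-labelF p i (t ∷ ts) (ψ , ψs) = begin
      chargesF p (proj₁ (labelF lab i (t ∷ ts)))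
        ≡⟨ cong (λ r → chargesF p (proj₁ r)) (labelF-cons lab i t ts) ⟩
      chargesT p (proj₁ (labelT lab i t)) ++ chargesF p (proj₁ (labelF lab (proj₂ (labelT lab i t)) ts))
        ≡⟨ cong₂ _++_ (chargesT-labelT p i t ψ)
                      (trans (cong (λ j → chargesF p (proj₁ (labelF lab j ts))) (counter-labelT lab i t)) (chargesF-labelF p (i + sizeT t) ts ψs)) ⟩
      map (labelled (chargeCount (leafMaskT t) i)) (leavesT i t) ++ map (labelled (chargeCount (leafMaskF ts) (i + sizeT t))) (leavesF (i + sizeT t) ts)
        ≡⟨ cong₂ _++_ (map-cong-∈ _ _ (leavesT i t) (λ m m∈ → cong (lab m ,_) (sym (chargeCount-++ˡ i t ts m m∈))))
                      (map-cong-∈ _ _ (leavesF (i + sizeT t) ts) (λ m m∈ → cong (lab m ,_) (sym (chargeCount-++ʳ p i t ts ψ m m∈)))) ⟩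
      map (labelled C) (leavesT i t) ++ map (labelled C) (leavesF (i + sizeT t) ts)
        ≡⟨ sym (LP.map-++ (labelled C) (leavesT i t) _) ⟩
      map (labelled C) (leavesF i (t ∷ ts))
        ∎
      where
      open ≡-Reasoning
      C : ℕ → ℕ
      C = chargeCount (leafMaskT t ++ leafMaskF ts) i

module Emission (ℓ : ℕ → ℕ) (ℓ-ge : ∀ g → g ≤ ℓ g) where

  open ChargeCounts ℓ ℓ-ge

  LastLeaf : ℕ → ℕ → List PTree → Set
  LastLeaf p i cs = Σ (List ℕ) λ init → leavesF (suc i) cs ≡ init ++ ℓ i ∷ []

  lastLeaf-∈ : ∀ p i cs → LastLeaf p i cs → ℓ i ∈ leavesF (suc i) cs
  lastLeaf-∈ p i cs (init , split) = subst (ℓ i ∈_) (sym split) (∈-++⁺ʳ init (here refl))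

  open WithinSubtrees LastLeaf lastLeaf-∈

  emit-one-more : ∀ n → emit (true ∷ []) (suc n ∷ []) ≡ emit (true ∷ []) (n ∷ []) ++ d ∷ []
  emit-one-more n = cong (u ∷_) (begin
    replicate (suc (suc n)) d ++ []  ≡⟨ LP.++-identityʳ (replicate (suc (suc n)) d) ⟩
    replicate (suc (suc n)) d        ≡⟨ sym (replicate-snoc (suc n)) ⟩
    replicate (suc n) d ++ d ∷ []    ≡⟨ cong (_++ d ∷ []) (sym (LP.++-identityʳ (replicate (suc n) d))) ⟩
    (replicate (suc n) d ++ []) ++ d ∷ [] ∎)
    where open ≡-Reasoning

  -- The internal vertex closes with one more down step after its last leaf.
  emit-node : ∀ i c cs init → leavesF (suc i) (c ∷ cs) ≡ init ++ ℓ i ∷ [] →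
    emit (leafMaskF (c ∷ cs)) (map (chargeCount (leafMaskF (c ∷ cs)) (suc i)) (leavesF (suc i) (c ∷ cs))) ≡ wordF (c ∷ cs) →
    emit (leafMaskF (c ∷ cs)) (map (λ m → indicator (ℓ i) m + chargeCount (leafMaskF (c ∷ cs)) (suc i) m) (leavesF (suc i) (c ∷ cs)))
      ≡ wordF (c ∷ cs) ++ d ∷ []
  emit-node i c cs init split emits with leafMaskF-last c cs
  ... | ys , mask = begin
    emit (leafMaskF (c ∷ cs)) (map (λ m → indicator (ℓ i) m + K m) (leavesF (suc i) (c ∷ cs)))
      ≡⟨ cong₂ emit mask (trans (cong (map _) split) (charge-node (λ _ n → n) i init [] K increasing)) ⟩
    emit (ys ++ true ∷ []) (map K init ++ suc k ∷ [])
      ≡⟨ emit-++ ys (true ∷ []) (map K init) (suc k ∷ []) count ⟩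
    emit ys (map K init) ++ emit (true ∷ []) (suc k ∷ [])
      ≡⟨ cong (emit ys (map K init) ++_) (emit-one-more k) ⟩
    emit ys (map K init) ++ emit (true ∷ []) (k ∷ []) ++ d ∷ []
      ≡⟨ sym (LP.++-assoc (emit ys (map K init)) _ (d ∷ [])) ⟩
    (emit ys (map K init) ++ emit (true ∷ []) (k ∷ [])) ++ d ∷ []
      ≡⟨ cong (_++ d ∷ []) (sym (emit-++ ys (true ∷ []) (map K init) (k ∷ []) count)) ⟩
    emit (ys ++ true ∷ []) (map K init ++ k ∷ []) ++ d ∷ []
      ≡⟨ cong (_++ d ∷ []) (trans (cong₂ emit (sym mask) (trans (sym (LP.map-++ K init (ℓ i ∷ []))) (cong (map K) (sym split)))) emits) ⟩
    wordF (c ∷ cs) ++ d ∷ []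
      ∎
    where
    open ≡-Reasoning
    K : ℕ → ℕ
    K = chargeCount (leafMaskF (c ∷ cs)) (suc i)
    k = K (ℓ i)
    increasing : AllPairs _<_ (init ++ ℓ i ∷ [])
    increasing = subst (AllPairs _<_) split (leavesF-increasing (suc i) (c ∷ cs))
    count : countTrue ys ≡ length (map K init)
    count = NP.+-cancelʳ-≡ 1 _ _ (begin
      countTrue ys + 1                 ≡⟨ sym (countTrue-++ ys (true ∷ [])) ⟩
      countTrue (ys ++ true ∷ [])      ≡⟨ cong countTrue (sym mask) ⟩
      countTrue (leafMaskF (c ∷ cs))   ≡⟨ countTrue-leafMaskF (suc i) (c ∷ cs) ⟩
      length (leavesF (suc i) (c ∷ cs)) ≡⟨ cong length split ⟩
      length (init ++ ℓ i ∷ [])        ≡⟨ LP.length-++ init ⟩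
      length init + 1                  ≡⟨ cong (_+ 1) (sym (LP.length-map K init)) ⟩
      length (map K init) + 1          ∎)

  mutual
    emit-leafMaskT : ∀ p i t → EveryInternalT LastLeaf p i t → emit (leafMaskT t) (map (chargeCount (leafMaskT t) i) (leavesT i t)) ≡ wordT t
    emit-leafMaskT p i (node [])       _ = refl
    emit-leafMaskT p i (node (c ∷ cs)) ((init , split) , ψs) =
      cong (u ∷_) (emit-node i c cs init split (emit-leafMaskF (suc p) (suc i) (c ∷ cs) ψs))

    emit-leafMaskF : ∀ p i ts → EveryInternalF LastLeaf p i ts → emit (leafMaskF ts) (map (chargeCount (leafMaskF ts) i) (leavesF i ts)) ≡ wordF ts
    emit-leafMaskF p i []       _        = refl
    emit-leafMaskF p i (t ∷ ts) (ψ , ψs) = begin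
      emit (leafMaskT t ++ leafMaskF ts) (map C (leavesT i t ++ leavesF j ts))
        ≡⟨ cong (emit (leafMaskT t ++ leafMaskF ts)) (LP.map-++ C (leavesT i t) (leavesF j ts)) ⟩
      emit (leafMaskT t ++ leafMaskF ts) (map C (leavesT i t) ++ map C (leavesF j ts))
        ≡⟨ emit-++ (leafMaskT t) (leafMaskF ts) (map C (leavesT i t)) _ (trans (countTrue-leafMaskT i t) (sym (LP.length-map C (leavesT i t)))) ⟩
      emit (leafMaskT t) (map C (leavesT i t)) ++ emit (leafMaskF ts) (map C (leavesF j ts))
        ≡⟨ cong₂ _++_ (cong (emit (leafMaskT t)) (map-cong-∈ _ _ (leavesT i t) (chargeCount-++ˡ i t ts)))
                      (cong (emit (leafMaskF ts)) (map-cong-∈ _ _ (leavesF j ts) (chargeCount-++ʳ p i t ts ψ))) ⟩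
      emit (leafMaskT t) (map (chargeCount (leafMaskT t) i) (leavesT i t)) ++ emit (leafMaskF ts) (map (chargeCount (leafMaskF ts) j) (leavesF j ts))
        ≡⟨ cong₂ _++_ (emit-leafMaskT p i t ψ) (emit-leafMaskF p j ts ψs) ⟩
      wordT t ++ wordF ts
        ∎
      where
      open ≡-Reasoning
      j = i + sizeT t
      C : ℕ → ℕ
      C = chargeCount (leafMaskT t ++ leafMaskF ts) i

module _ (Ψ : ℕ → ℕ → List PTree → Set) where

  mutual
    everyInternalT : ∀ p i t → (∀ j c cs e → nth (subtreesT p t) j ≡ just (node (c ∷ cs) , e) → Ψ (suc e) (i + j) (c ∷ cs)) →
                     EveryInternalT Ψ (suc p) i t
    everyInternalT p i (node [])       hyp = tt
    everyInternalT p i (node (c ∷ cs)) hyp =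
      subst (λ j → Ψ (suc p) j (c ∷ cs)) (NP.+-identityʳ i) (hyp 0 c cs p refl) ,
      everyInternalF (suc p) (suc i) (c ∷ cs) (λ j c′ cs′ e at → subst (λ k → Ψ (suc e) k (c′ ∷ cs′)) (NP.+-suc i j) (hyp (suc j) c′ cs′ e at))

    everyInternalF : ∀ p i ts → (∀ j c cs e → nth (subtreesF p ts) j ≡ just (node (c ∷ cs) , e) → Ψ (suc e) (i + j) (c ∷ cs)) →
                     EveryInternalF Ψ (suc p) i ts
    everyInternalF p i []       hyp = tt
    everyInternalF p i (t ∷ ts) hyp =
      everyInternalT p i t (λ j c cs e at → hyp j c cs e (trans (nth-++ˡ (subtreesT p t) (subtreesF p ts) j (nth-just-< (subtreesT p t) j at)) at)) ,
      everyInternalF p (i + sizeT t) ts λ j c cs e at →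
        subst (λ k → Ψ (suc e) k (c ∷ cs)) (trans (cong (λ n → i + (n + j)) (length-subtreesT p t)) (sym (NP.+-assoc i (sizeT t) j)))
              (hyp (length (subtreesT p t) + j) c cs e (trans (nth-++ʳ (subtreesT p t) (subtreesF p ts) j) at))

depthOf : List PTree → ℕ → ℕ
depthOf cs g = maybe proj₂ 0 (nth (subtreesF 0 cs) g)

edgeDepths-nth : ∀ cs g → g < sizeF cs → nth (edgeDepthsF 0 cs) g ≡ just (depthOf cs g)
edgeDepths-nth cs g g<cs with subtreesF-lookup cs g g<cs
... | x , at = begin
  nth (edgeDepthsF 0 cs) g                       ≡⟨ cong (λ ds → nth ds g) (edgeDepthsF-subtrees 0 cs) ⟩
  nth (map proj₂ (subtreesF 0 cs)) g             ≡⟨ nth-map proj₂ (subtreesF 0 cs) g ⟩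
  Data.Maybe.map proj₂ (nth (subtreesF 0 cs) g)  ≡⟨ cong (Data.Maybe.map proj₂) at ⟩
  just (proj₂ x)                                 ≡⟨ cong (λ r → just (maybe proj₂ 0 r)) (sym at) ⟩
  just (depthOf cs g)                            ∎
  where open ≡-Reasoning

depth-descendant : ∀ cs g h → g < sizeF cs → g < h → h < g + subtreeSize (wordF cs) g → suc (depthOf cs g) ≤ depthOf cs h
depth-descendant cs g h g<cs g<h h<end with subtreesF-lookup cs g g<cs
... | (node ch , e) , at with segmentF 0 cs g (node ch) e at | index-split (suc g) h
... | _                    | inj₁ h<g+1      = ⊥-elim (NP.<⇒≱ g<h (NP.≤-pred h<g+1))
... | A , B , split , refl | inj₂ (j , refl) =
  subst₂ _≤_ (cong suc (sym (cong (maybe proj₂ 0) at))) (cong (maybe proj₂ 0) (sym at-h))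
         (depth-belowF (suc e) ch x (nth-∈ (subtreesF (suc e) ch) j x-at))
  where
  L = length A
  j<ch : j < length (subtreesF (suc e) ch)
  j<ch = subst (j <_) (sym (length-subtreesF (suc e) ch))
    (NP.+-cancelˡ-< (suc L) j (sizeF ch)
      (subst (suc L + j <_) (NP.+-suc L (sizeF ch)) (subst (λ n → suc L + j < L + n) (subtreeSize-at cs L (node ch) e at) h<end)))
  x = proj₁ (nth-just (subtreesF (suc e) ch) j j<ch)
  x-at : nth (subtreesF (suc e) ch) j ≡ just x
  x-at = proj₂ (nth-just (subtreesF (suc e) ch) j j<ch)
  at-h : nth (subtreesF 0 cs) (suc L + j) ≡ just x
  at-h = begin
    nth (subtreesF 0 cs) (suc L + j)                ≡⟨ cong₂ nth split (sym (NP.+-suc L j)) ⟩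
    nth (A ++ subtreesT e (node ch) ++ B) (L + suc j) ≡⟨ nth-++ʳ A _ (suc j) ⟩
    nth (subtreesF (suc e) ch ++ B) j               ≡⟨ nth-++ˡ (subtreesF (suc e) ch) B j j<ch ⟩
    nth (subtreesF (suc e) ch) j                    ≡⟨ x-at ⟩
    just x                                          ∎
    where open ≡-Reasoning

¬label≤threshold : ∀ a e → e ≤ a → ¬ (+ a ≤ℤ threshold (suc e))
¬label≤threshold a zero    _   ()
¬label≤threshold a (suc e) e≤a (Z.+≤+ a≤e-1) = NP.<⇒≱ e≤a a≤e-1

-1≤threshold : ∀ e → -[1+ 0 ] ≤ℤ threshold (suc e)
-1≤threshold zero    = Z.-≤- z≤n
-1≤threshold (suc e) = Z.-≤+

label≤threshold : ∀ b e → b < e → + b ≤ℤ threshold (suc e)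
label≤threshold b (suc e) (s≤s b≤e) = Z.+≤+ b≤e

labelRoot-node : ∀ P cs → labelRoot P (node cs) ≡ proj₁ (labelF (leafLabel P (rootEdgeDepths (node cs))) 0 cs)
labelRoot-node P cs with labelF (leafLabel P (rootEdgeDepths (node cs))) 0 cs
... | tree , _ = refl

-- Synchronized intervals

module SynchronizedForests (csP csQ : List PTree) (sizes : size (wordF csP) ≡ size (wordF csQ)) (nonempty : 1 ≤ size (wordF csP))
                           (P≤Q : wordF csP ≤T wordF csQ) (types : Type (wordF csP) ≡ Type (wordF csQ)) where

  P Q : List Step
  P = wordF csP
  Q = wordF csQ

  same-size : sizeF csP ≡ sizeF csQ
  same-size = trans (sym (size-wordF csP)) (trans sizes (size-wordF csQ))

  same-mask : leafMaskF csP ≡ leafMaskF csQ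
  same-mask = Type⇒leafMask csP csQ P≥1 (subst (1 ≤_) same-size P≥1) types
    where
    P≥1 : 1 ≤ sizeF csP
    P≥1 = subst (1 ≤_) (size-wordF csP) nonempty

  subtreeSize-P≤Q : ∀ g → subtreeSize P g ≤ subtreeSize Q g
  subtreeSize-P≤Q = subtreeSize-tamari P Q P≤Q

  depths : List ℕ
  depths = edgeDepthsF 0 csQ

  lab : ℕ → ℤ
  lab = leafLabel P depths

  -- The internal vertex below edge g charges the last leaf of its subtree in P.
  ℓ : ℕ → ℕ
  ℓ g = g + (subtreeSize P g ∸ 1)

  ℓ-ge : ∀ g → g ≤ ℓ g
  ℓ-ge g = NP.m≤m+n g _

  <sizeF⇒<size : ∀ m → m < sizeF csP → m < size P
  <sizeF⇒<size m m<P = subst (m <_) (sym (size-wordF csP)) m<P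

  open LeafLabels P (wordF-nonneg csP) (λ f f<P → excursion-at csP f (subst (f <_) (size-wordF csP) f<P))
                  depths (depthOf csQ) (λ g g<P → edgeDepths-nth csQ g (subst (g <_) (trans (size-wordF csP) same-size) g<P))
  open ChargeCounts ℓ ℓ-ge
  module Q-side = LabelCharges lab ℓ ℓ-ge
  module P-side = Emission ℓ ℓ-ge

  lastLeaf-isLeaf : ∀ f a → subtreeSize P f ≡ suc (suc a) → f < sizeF csP → nth (leafMaskF csP) (f + suc a) ≡ just true
  lastLeaf-isLeaf f a size-f f<P with subtreesF-lookup csP f f<P
  ... | (t , e) , at with leafMaskT-last t
  ... | ys , mask = begin
    nth (leafMaskF csP) (f + suc a)         ≡⟨ cong (λ n → nth (leafMaskF csP) (f + n)) (sym length-ys) ⟩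
    nth (leafMaskF csP) (f + length ys)     ≡⟨ leafMask-segment csP f t e at (length ys) (subst (length ys <_) (sym size-t) (subst (_< suc (suc a)) (sym length-ys) NP.≤-refl)) ⟩
    nth (leafMaskT t) (length ys)           ≡⟨ cong (λ bs → nth bs (length ys)) mask ⟩
    nth (ys ++ true ∷ []) (length ys)       ≡⟨ nth-length-++ ys true [] ⟩
    just true                               ∎
    where
    open ≡-Reasoning
    size-t : sizeT t ≡ suc (suc a)
    size-t = trans (sym (subtreeSize-at csP f t e at)) size-f
    length-ys : length ys ≡ suc a
    length-ys = NP.suc-injective (begin
      suc (length ys)              ≡⟨ NP.+-comm 1 (length ys) ⟩
      length ys + 1                ≡⟨ sym (LP.length-++ ys) ⟩
      length (ys ++ true ∷ [])     ≡⟨ cong length (sym mask) ⟩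
      length (leafMaskT t)         ≡⟨ length-leafMaskT t ⟩
      sizeT t                      ≡⟨ size-t ⟩
      suc (suc a)                  ∎)

  leaf-∈-subtree : ∀ f c cs e → nth (subtreesF 0 csQ) f ≡ just (node (c ∷ cs) , e) → ∀ a → suc a < suc (sizeF (c ∷ cs)) →
                   nth (leafMaskF csQ) (f + suc a) ≡ just true → f + suc a ∈ leavesF (suc f) (c ∷ cs)
  leaf-∈-subtree f c cs e at a a<size is-leaf =
    subst (_∈ leavesF (suc f) (c ∷ cs)) (sym (NP.+-suc f a))
          (subst (suc f + a ∈_) (sym (leavesF-leavesOfMask (suc f) (c ∷ cs))) (leavesOfMask-∈ (suc f) (leafMaskF (c ∷ cs)) a below))
    where
    below : nth (leafMaskF (c ∷ cs)) a ≡ just true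
    below = trans (sym (leafMask-segment csQ f (node (c ∷ cs)) e at (suc a) a<size)) is-leaf

  depth-inside : ∀ f t e g → nth (subtreesF 0 csQ) f ≡ just (t , e) → f < sizeF csQ → f ≤ g → g < f + subtreeSize Q f → e ≤ depthOf csQ g
  depth-inside f t e g at f<Q f≤g g<end with NP.m≤n⇒m<n∨m≡n f≤g
  ... | inj₂ refl = NP.≤-reflexive (sym (cong (maybe proj₂ 0) at))
  ... | inj₁ f<g  = NP.≤-trans (NP.n≤1+n e) (subst (λ n → suc n ≤ depthOf csQ g) (cong (maybe proj₂ 0) at) (depth-descendant csQ f g f<Q f<g g<end))

  early-leaf-high : ∀ f c cs e → nth (subtreesF 0 csQ) f ≡ just (node (c ∷ cs) , e) → f < sizeF csQ → ∀ a → subtreeSize P f ≡ suc (suc a) →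
    ∀ m → m ∈ leavesF (suc f) (c ∷ cs) → m < f + suc a → ¬ (lab m ≤ℤ threshold (suc e))
  early-leaf-high f c cs e at f<Q a size-f m m∈ m<last
    with ∈-leavesOfMask (suc f) (leafMaskF (c ∷ cs)) m (subst (m ∈_) (leavesF-leavesOfMask (suc f) (c ∷ cs)) m∈)
  ... | j , m≡ , is-leaf =
    subst (λ z → ¬ (z ≤ℤ threshold (suc e))) (sym (proj₂ (proj₂ (proj₂ labelled-inside))))
          (¬label≤threshold _ e (depth-inside f (node (c ∷ cs)) e (proj₁ labelled-inside) at f<Q (proj₁ (proj₂ labelled-inside))
                                               (NP.<-≤-trans (proj₁ (proj₂ (proj₂ labelled-inside))) (NP.+-monoʳ-≤ f (subtreeSize-P≤Q f)))))
    where
    m≡f+1+j : m ≡ f + suc j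
    m≡f+1+j = trans m≡ (sym (NP.+-suc f j))
    leaf-P : nth (leafMaskF csP) m ≡ just true
    leaf-P = subst (λ bs → nth bs m ≡ just true) (sym same-mask)
      (trans (cong (nth (leafMaskF csQ)) m≡f+1+j) (trans (leafMask-segment csQ f (node (c ∷ cs)) e at (suc j) (s≤s (leafMask-index< (c ∷ cs) j is-leaf))) is-leaf))
    f<m : f < m
    f<m = subst (f <_) (sym m≡f+1+j) (NP.m<m+n f (s≤s z≤n))
    m+1<end : suc m < f + subtreeSize P f
    m+1<end = NP.≤-trans (s≤s m<last) (NP.≤-reflexive (trans (sym (NP.+-suc f (suc a))) (cong (λ n → f + n) (sym size-f))))
    labelled-inside = leafLabel-inner f m (<sizeF⇒<size m (leafMask-index< csP m leaf-P)) (subtreeSize-leaf csP m leaf-P) f<m m+1<end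

  last-leaf-low : ∀ f t e a → nth (subtreesF 0 csQ) f ≡ just (t , e) → f < sizeF csQ → subtreeSize P f ≡ suc (suc a) →
    subtreeSize P (f + suc a) ≡ 1 → f + suc a < size P → lab (f + suc a) ≤ℤ threshold (suc e)
  last-leaf-low f t e a at f<Q size-f is-leaf last<P
    with leafLabel-closing f (f + suc a) last<P is-leaf (NP.m<m+n f (s≤s z≤n)) (trans (sym (NP.+-suc f (suc a))) (cong (λ n → f + n) (sym size-f)))
  ... | inj₁ label-1 = subst (_≤ℤ threshold (suc e)) (sym label-1) (-1≤threshold e)
  ... | inj₂ (g , g<f , f<end , label-g) =
    subst (_≤ℤ threshold (suc e)) (sym label-g) (label≤threshold (depthOf csQ g) e
      (subst (depthOf csQ g <_) (cong (maybe proj₂ 0) at)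
             (depth-descendant csQ g f (NP.<-trans g<f f<Q) g<f (NP.<-≤-trans f<end (NP.+-monoʳ-≤ g (subtreeSize-P≤Q g))))))

  firstLowLeaf-Q : ∀ f c cs e → nth (subtreesF 0 csQ) f ≡ just (node (c ∷ cs) , e) → Q-side.FirstLowLeaf (suc e) f (c ∷ cs)
  firstLowLeaf-Q f c cs e at with subtreeSize-internal csP f (subst (λ bs → nth bs f ≡ just false) (sym same-mask) (leafMask-at csQ f _ e at))
  ... | a , size-f = pre , post , split′ , early-high , last-low
    where
    f<Q : f < sizeF csQ
    f<Q = subst (f <_) (length-subtreesF 0 csQ) (nth-just-< (subtreesF 0 csQ) f at)
    ℓf≡ : ℓ f ≡ f + suc a
    ℓf≡ = cong (λ n → f + (n ∸ 1)) size-f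
    leaf-P : nth (leafMaskF csP) (f + suc a) ≡ just true
    leaf-P = lastLeaf-isLeaf f a size-f (subst (f <_) (sym same-size) f<Q)
    last∈ : f + suc a ∈ leavesF (suc f) (c ∷ cs)
    last∈ = leaf-∈-subtree f c cs e at a (subst₂ _≤_ size-f (subtreeSize-at csQ f _ e at) (subtreeSize-P≤Q f))
                           (subst (λ bs → nth bs (f + suc a) ≡ just true) same-mask leaf-P)
    pre  = proj₁ (∈-∃++ last∈)
    post = proj₁ (proj₂ (∈-∃++ last∈))
    split : leavesF (suc f) (c ∷ cs) ≡ pre ++ (f + suc a) ∷ post
    split = proj₂ (proj₂ (∈-∃++ last∈))
    split′ : leavesF (suc f) (c ∷ cs) ≡ pre ++ ℓ f ∷ post
    split′ = trans split (cong (λ n → pre ++ n ∷ post) (sym ℓf≡))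
    early-high : ∀ m → m ∈ pre → ¬ (lab m ≤ℤ threshold (suc e))
    early-high m m∈ = early-leaf-high f c cs e at f<Q a size-f m (subst (m ∈_) (sym split) (∈-++⁺ˡ m∈))
      (proj₁ (allPairs-split pre (f + suc a) post (subst (AllPairs _<_) split (leavesF-increasing (suc f) (c ∷ cs)))) m m∈)
    last-low : lab (ℓ f) ≤ℤ threshold (suc e)
    last-low = subst (λ n → lab n ≤ℤ threshold (suc e)) (sym ℓf≡)
      (last-leaf-low f _ e a at f<Q size-f (subtreeSize-leaf csP (f + suc a) leaf-P) (<sizeF⇒<size _ (leafMask-index< csP _ leaf-P)))

  lastLeaf-P : ∀ f c cs e → nth (subtreesF 0 csP) f ≡ just (node (c ∷ cs) , e) → P-side.LastLeaf (suc e) f (c ∷ cs)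
  lastLeaf-P f c cs e at with leavesF-last (suc f) c cs
  ... | init , split = init , trans split (cong (λ n → init ++ f + (n ∸ 1) ∷ []) (sym (subtreeSize-at csP f _ e at)))

  tree : LabelledTree
  tree = proj₁ (labelF lab 0 csQ)

  R≡tree : R P Q ≡ just tree
  R≡tree = trans (cong (RAux P) (decode-wordF csQ)) (cong just (labelRoot-node P csQ))

  Qmap-tree : Qmap tree ≡ Q
  Qmap-tree = contourF-labelF lab 0 csQ

  Pmap-tree : Pmap tree ≡ P
  Pmap-tree =
    trans (cong₂ emit (shapeF-labelF lab 0 csQ) (cong (map proj₂) (Q-side.chargesF-labelF 1 0 csQ (everyInternalF Q-side.FirstLowLeaf 0 0 csQ firstLowLeaf-Q))))
    (trans (cong (emit (leafMaskF csQ)) (sym (LP.map-∘ (leavesF 0 csQ))))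
    (trans (cong₂ (λ bs xs → emit bs (map (chargeCount bs 0) xs)) (sym same-mask) same-leaves)
           (P-side.emit-leafMaskF 1 0 csP (everyInternalF P-side.LastLeaf 0 0 csP lastLeaf-P))))
    where
    same-leaves : leavesF 0 csQ ≡ leavesF 0 csP
    same-leaves = trans (leavesF-leavesOfMask 0 csQ) (trans (cong (leavesOfMask 0) (sym same-mask)) (sym (leavesF-leavesOfMask 0 csP)))

proposition9 : (P Q : List Step) → Synchronized P Q →
    Σ LabelledTree (λ T → (R P Q ≡ just T) × (Pmap T ≡ P) × (Qmap T ≡ Q))
proposition9 P Q (P-dyck , Q-dyck , sizes , nonempty , P≤Q , types) with dyck⇒wordF P P-dyck | dyck⇒wordF Q Q-dyck
... | csP , refl | csQ , refl = tree , R≡tree , Pmap-tree , Qmap-tree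
  where open SynchronizedForests csP csQ sizes nonempty P≤Q types
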